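{- As formal power series in $z$, $$\frac{A(x,2z)}{A(x,z)}=C^E(x,z),\qquad \frac{B(x,z)}{A(x,z)}=1+xC^O(x,z).$$
   Context: $A_n(x)=\sum_{\pi\in\mathcal{S}_n}x^{{\rm des}_A(\pi)}$ is the Eulerian polynomial ($\mathcal{S}_n$ the symmetric group, ${\rm des}_A(\pi)=\#\{i\in[n-1]:\pi(i)>\pi(i+1)\}$, $A_0=1$), and $B_n(x)=\sum_{\pi\in\mathcal{S}^B_n}x^{{\rm des}_B(\pi)}$ is the type $B$ Eulerian polynomial, where $\mathcal{S}^B_n$ is the set of signed permutations of $\pm[n]$ (with $\pi(-i)=-\pi(i)$) and ${\rm des}_B(\pi)=\#\{i\in\{0,\ldots,n-1\}:\pi(i)>\pi(i+1)\}$ with $\pi(0)=0$; $B_0=1$. Let $A(x,z)=\sum_{n\ge0}A_n(x)\frac{z^n}{n!}$, $B(x,z)=\sum_{n\ge0}B_n(x)\frac{z^n}{n!}$. For $n\ge1$ let $C_n^+=\{\pi\in\mathcal{S}^B_n:\pi(1)>0\}$, $C_n^-=\{\pi\in\mathcal{S}^B_n:\pi(1)<0\}$, $C_n^E(x)=\sum_{\pi\in C_n^+}x^{{\rm des}_A(\pi)}$, $C_n^O(x)=\sum_{\pi\in C_n^- }x^{{\rm des}_A(\pi)}$ (with ${\rm des}_A$ of a signed permutation $\pi(1)\cdots\pi(n)$ computed in the usual integer order), and let $C^E(x,z)=1+\sum_{n\ge1}C_n^E(x)\frac{z^n}{n!}$, $C^O(x,z)=\sum_{n\ge1}C_n^O(x)\frac{z^n}{n!}$.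 -}

module Defs where

open import Data.Nat using (ℕ; zero; suc; _+_; _*_; _∸_; _^_; _≡ᵇ_)
open import Data.Nat.Combinatorics using (_C_)
open import Data.Integer using (ℤ; +_; -_; _<?_)
open import Data.List using (List; []; _∷_; [_]; map; concatMap; upTo)
open import Data.Bool using (Bool; true; false; if_then_else_)
open import Relation.Nullary using (does)

-- Polynomials in x with ℕ coefficients: p j = coefficient of x^j.
Poly : Set
Poly = ℕ → ℕ

zeroP : Poly
zeroP _ = 0

oneP : Poly
oneP zero    = 1
oneP (suc _) = 0

xP : Poly → Poly
xP p zero    = 0
xP p (suc j) = p j

sumTo : ℕ → (ℕ → ℕ) → ℕ
sumTo zero    f = f 0
sumTo (suc n) f = sumTo n f + f (suc n)

_⊛_ : Poly → Poly → Poly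
(p ⊛ q) j = sumTo j (λ i → p i * q (j ∸ i))

-- Formal power series in z with Poly coefficients, in exponential form:
-- F n is the coefficient of z^n / n!.
Series : Set
Series = ℕ → Poly

egfMul : Series → Series → Series
egfMul F G n j = sumTo n (λ k → (n C k) * (F k ⊛ G (n ∸ k)) j)

-- F(x,2z): the n-th coefficient is 2^n F_n
dilate2 : Series → Series
dilate2 F n j = 2 ^ n * F n j

onePlusX : Series → Series
onePlusX F zero    j = oneP j + xP (F zero) j
onePlusX F (suc n) j = xP (F (suc n)) j

insertions : {A : Set} → A → List A → List (List A)
insertions a []       = [ a ∷ [] ]
insertions a (b ∷ bs) = (a ∷ b ∷ bs) ∷ map (b ∷_) (insertions a bs)

perms : {A : Set} → List A → List (List A)
perms []       = [ [] ]
perms (a ∷ as) = concatMap (insertions a) (perms as)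

range : ℕ → List ℤ
range n = map (λ i → + suc i) (upTo n)

Sym : ℕ → List (List ℤ)
Sym n = perms (range n)

signings : List ℤ → List (List ℤ)
signings []       = [ [] ]
signings (a ∷ as) = concatMap (λ s → (a ∷ s) ∷ ((- a) ∷ s) ∷ []) (signings as)

-- S^B_n : signed permutations π(1)…π(n) (π(-i) = -π(i) is implicit)
SymB : ℕ → List (List ℤ)
SymB n = concatMap signings (Sym n)

desA : List ℤ → ℕ
desA (a ∷ b ∷ r) = (if does (b <? a) then 1 else 0) + desA (b ∷ r)
desA _           = 0

desB : List ℤ → ℕ
desB w = desA (+ 0 ∷ w)

count : {A : Set} → (A → Bool) → List A → ℕ
count P []       = 0
count P (a ∷ as) = (if P a then 1 else 0) + count P as

filterᵇ : {A : Set} → (A → Bool) → List A → List A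
filterᵇ P []       = []
filterᵇ P (a ∷ as) = if P a then a ∷ filterᵇ P as else filterᵇ P as

genPoly : {A : Set} → List A → (A → ℕ) → Poly
genPoly L stat j = count (λ π → stat π ≡ᵇ j) L

firstPos : List ℤ → Bool
firstPos []      = false
firstPos (a ∷ _) = does (+ 0 <? a)

firstNeg : List ℤ → Bool
firstNeg []      = false
firstNeg (a ∷ _) = does (a <? + 0)

-- A_n(x) (A_0 = 1 since S_0 has the single empty permutation)
Aₙ : ℕ → Poly
Aₙ n = genPoly (Sym n) desA

Bₙ : ℕ → Poly
Bₙ n = genPoly (SymB n) desB

CE : Series
CE zero    = oneP
CE (suc n) = genPoly (filterᵇ firstPos (SymB (suc n))) desA

CO : Series
CO zero    = zeroP
CO (suc n) = genPoly (filterᵇ firstNeg (SymB (suc n))) desA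

Aser : Series
Aser = Aₙ

Bser : Series
Bser = Bₙ

-- Cut a signed permutation w of [n] after its longest prefix u of letters of one sign.  Then u is
-- a permutation of a k-subset carrying that sign, and the rest v is a signed permutation of the
-- complementary set that does not start with that sign.  Descent numbers only see the relative
-- order of the letters, so u contributes A_k and v the coefficient of C^E (negative prefix, des_A:
-- the cut is an ascent) or of 1 + x C^O (positive prefix, des_B: the cut is a descent into a
-- negative letter); choosing the k-subset is the binomial convolution of exponential generating
-- functions.  The left side of the first identity counts all signed permutations by des_A, and
-- choosing the signs before the order shows that this is 2^n A_n.

module Submission where

open import Data.Bool using (Bool; true; false; if_then_else_; not; _∧_)
open import Data.Bool.Properties using (T-≡; not-injective)
open import Data.Empty using (⊥; ⊥-elim)
open import Data.Integer using (ℤ; +_; -_; -[1+_]; 0ℤ; ∣_∣; +<+; -<+)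
import Data.Integer as ℤ
import Data.Integer.Properties as ℤ
open import Data.List using (List; []; _∷_; [_]; _++_; map; concat; concatMap; length; filter; drop; upTo)
import Data.List.Properties as List
open import Data.List.Membership.Propositional using (_∈_; _∉_)
open import Data.List.Membership.DecPropositional ℤ._≟_ using (_∈?_)
open import Data.List.Membership.Propositional.Properties
  using (∈-map⁺; ∈-map⁻; ∈-++⁺ˡ; ∈-++⁺ʳ; ∈-++⁻; ∈-concat⁺′; ∈-concat⁻′; ∈-filter⁺; ∈-filter⁻; ∈-∃++; ∈-upTo⁺)
open import Data.List.Membership.Propositional.Properties.WithK using (unique∧set⇒bag)
open import Data.List.Relation.Binary.BagAndSetEquality using (∼bag⇒↭; _∼[_]_; set)
open import Data.List.Relation.Binary.Permutation.Propositional
  using (_↭_; ↭-refl; ↭-sym; ↭-trans; prep; swap; ↭⇒↭ₛ)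
import Data.List.Relation.Binary.Permutation.Propositional as Perm
import Data.List.Relation.Binary.Permutation.Propositional.Properties as Perm
import Data.List.Relation.Binary.Permutation.Setoid.Properties as Permₛ
open import Data.List.Relation.Unary.Any using (here; there)
open import Data.List.Relation.Unary.All using (All; []; _∷_)
import Data.List.Relation.Unary.All as All
import Data.List.Relation.Unary.All.Properties as All
open import Data.List.Relation.Unary.AllPairs using (AllPairs; []; _∷_)
import Data.List.Relation.Unary.AllPairs as AllPairs
import Data.List.Relation.Unary.AllPairs.Properties as AllPairs
import Data.List.Relation.Unary.Linked.Properties as Linked
open import Data.List.Sort ℤ.≤-decTotalOrder using (sort; sort-↭; sort-↗)
open import Data.List.Relation.Unary.Unique.Propositional using (Unique)
import Data.List.Relation.Unary.Unique.Propositional.Properties as Unique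
open import Data.Nat using (ℕ; zero; suc; _+_; _*_; _^_; _≤_; _≡ᵇ_; z<s; s<s)
import Data.Nat as ℕ
import Data.Nat.Properties as Nat
open import Data.Nat.Combinatorics using (_C_; nCk+nC[k+1]≡[n+1]C[k+1])
open import Algebra.Properties.CommutativeSemigroup Nat.+-commutativeSemigroup using (x∙yz≈y∙xz; interchange)
open import Data.Product using (∃; ∃₂; _×_; _,_; proj₁; proj₂)
open import Data.Sum using (_⊎_; inj₁; inj₂)
open import Function.Base using (_∘_; _$_)
open import Function.Bundles using (mk⇔; Equivalence)
open import Relation.Binary.Definitions using (DecidableEquality; tri<; tri≈; tri>)
open import Relation.Nullary using (¬_; Dec; yes; no; does; ¬?)
open import Relation.Nullary.Decidable using (T?; dec-true; dec-false; does-⇔)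
open import Relation.Binary.PropositionalEquality hiding ([_])

open import Defs

private variable
  A B : Set

does-true⇒ : {P : Set} (p? : Dec P) → does p? ≡ true → P
does-true⇒ (yes p) _ = p

does-false⇒ : {P : Set} (p? : Dec P) → does p? ≡ false → ¬ P
does-false⇒ (no ¬p) _ = ¬p

count-++ : (P : A → Bool) (xs ys : List A) → count P (xs ++ ys) ≡ count P xs + count P ys
count-++ P []       ys = refl
count-++ P (x ∷ xs) ys = trans (cong₂ _+_ refl (count-++ P xs ys)) (sym (Nat.+-assoc (if P x then 1 else 0) _ _))

count-cong : {P Q : A → Bool} (xs : List A) → (∀ x → x ∈ xs → P x ≡ Q x) → count P xs ≡ count Q xs
count-cong []       eq = refl
count-cong (x ∷ xs) eq =
  cong₂ _+_ (cong (λ b → if b then 1 else 0) (eq x (here refl))) (count-cong xs (λ y m → eq y (there m)))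

count-map : (P : B → Bool) (f : A → B) (xs : List A) → count P (map f xs) ≡ count (λ x → P (f x)) xs
count-map P f []       = refl
count-map P f (x ∷ xs) = cong₂ _+_ refl (count-map P f xs)

count-filterᵇ : (P Q : A → Bool) (xs : List A) → count P (filterᵇ Q xs) ≡ count (λ x → Q x ∧ P x) xs
count-filterᵇ P Q []       = refl
count-filterᵇ P Q (x ∷ xs) with Q x
... | true  = cong₂ _+_ refl (count-filterᵇ P Q xs)
... | false = count-filterᵇ P Q xs

count-none : (P : A → Bool) (xs : List A) → (∀ x → x ∈ xs → P x ≡ false) → count P xs ≡ 0
count-none P xs none = trans (count-cong xs none) (count-false xs)
  where
  count-false : (xs : List A) → count (λ _ → false) xs ≡ 0
  count-false []       = refl
  count-false (_ ∷ xs) = count-false xs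

count-true : (xs : List A) → count (λ _ → true) xs ≡ length xs
count-true []       = refl
count-true (x ∷ xs) = cong suc (count-true xs)

count-↭ : (P : A → Bool) {xs ys : List A} → xs ↭ ys → count P xs ≡ count P ys
count-↭ P Perm.refl       = refl
count-↭ P (prep x p)      = cong₂ _+_ refl (count-↭ P p)
count-↭ P (swap x y p)    =
  trans (cong (λ n → χ x + (χ y + n)) (count-↭ P p)) (x∙yz≈y∙xz (χ x) (χ y) _)
  where
  χ : _ → ℕ
  χ z = if P z then 1 else 0
count-↭ P (Perm.trans p q) = trans (count-↭ P p) (count-↭ P q)

∈-concatMap⁺ : {f : A → List B} {y : B} {x : A} {xs : List A} → x ∈ xs → y ∈ f x → y ∈ concatMap f xs
∈-concatMap⁺ {f = f} x∈xs y∈fx = ∈-concat⁺′ y∈fx (∈-map⁺ f x∈xs)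

∈-concatMap⁻ : {f : A → List B} {y : B} (xs : List A) → y ∈ concatMap f xs → ∃ λ x → x ∈ xs × y ∈ f x
∈-concatMap⁻ {f = f} xs m with ∈-concat⁻′ (map f xs) m
... | ys , y∈ys , ys∈ with ∈-map⁻ f ys∈
...   | x , x∈xs , refl = x , x∈xs , y∈ys

count-concatMap-const : (P : B → Bool) (f : A → List B) (xs : List A) (c : ℕ) →
  (∀ x → x ∈ xs → count P (f x) ≡ c) → count P (concatMap f xs) ≡ length xs * c
count-concatMap-const P f []       c h = refl
count-concatMap-const P f (x ∷ xs) c h =
  trans (count-++ P (f x) (concatMap f xs))
        (cong₂ _+_ (h x (here refl)) (count-concatMap-const P f xs c (λ y m → h y (there m))))

Unique-resp-↭ : {xs ys : List A} → xs ↭ ys → Unique xs → Unique ys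
Unique-resp-↭ {A = A} p = Permₛ.Unique-resp-↭ (setoid A) (↭⇒↭ₛ p)

unique∧set⇒↭ : {xs ys : List A} → Unique xs → Unique ys → xs ∼[ set ] ys → xs ↭ ys
unique∧set⇒↭ u v xs≈ys = ∼bag⇒↭ (unique∧set⇒bag u v xs≈ys)

-- Distinct blocks are disjoint because a key function recovers the source of every element.
unique-concatMap⁺ : {f : A → List B} (key : B → A) (xs : List A) → Unique xs →
  (∀ x → x ∈ xs → Unique (f x)) → (∀ x y → x ∈ xs → y ∈ f x → key y ≡ x) →
  Unique (concatMap f xs)
unique-concatMap⁺ key []       _          _     _   = []
unique-concatMap⁺ {f = f} key (x ∷ xs) (x∉xs ∷ u) uniq keyed =
  Unique.++⁺ (uniq x (here refl))
             (unique-concatMap⁺ key xs u (λ z m → uniq z (there m)) (λ z y m → keyed z y (there m)))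
             disjoint
  where
  disjoint : ∀ {v} → v ∈ f x × v ∈ concatMap f xs → ⊥
  disjoint (v∈fx , v∈rest) with ∈-concatMap⁻ xs v∈rest
  ... | z , z∈xs , v∈fz =
    All.lookup x∉xs z∈xs (trans (sym (keyed x _ (here refl) v∈fx)) (keyed z _ (there z∈xs) v∈fz))

unique-map⇒injective : {f : A → B} (xs : List A) → Unique (map f xs) →
  ∀ {x y} → x ∈ xs → y ∈ xs → f x ≡ f y → x ≡ y
unique-map⇒injective (z ∷ zs) (_ ∷ _)  (here refl) (here refl) _  = refl
unique-map⇒injective {f = f} (z ∷ zs) (fz∉ ∷ _) (here refl) (there y∈) eq =
  ⊥-elim (All.lookup fz∉ (∈-map⁺ f y∈) eq)
unique-map⇒injective {f = f} (z ∷ zs) (fz∉ ∷ _) (there x∈) (here refl) eq =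
  ⊥-elim (All.lookup fz∉ (∈-map⁺ f x∈) (sym eq))
unique-map⇒injective (z ∷ zs) (_ ∷ u)  (there x∈) (there y∈) eq = unique-map⇒injective zs u x∈ y∈ eq

unique-++⁻ˡ : (xs : List A) {ys : List A} → Unique (xs ++ ys) → Unique xs
unique-++⁻ˡ []       _       = []
unique-++⁻ˡ (x ∷ xs) (x∉ ∷ u) = All.++⁻ˡ xs x∉ ∷ unique-++⁻ˡ xs u

unique-++⁻ʳ : (xs : List A) {ys : List A} → Unique (xs ++ ys) → Unique ys
unique-++⁻ʳ []       u       = u
unique-++⁻ʳ (x ∷ xs) (_ ∷ u) = unique-++⁻ʳ xs u

unique-++⇒disjoint : (xs : List A) {ys : List A} → Unique (xs ++ ys) → ∀ {z} → z ∈ xs → z ∉ ys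
unique-++⇒disjoint (x ∷ xs) (x∉ ∷ _) (here refl) z∈ys = All.lookup (All.++⁻ʳ xs x∉) z∈ys refl
unique-++⇒disjoint (x ∷ xs) (_ ∷ u)  (there z∈)  z∈ys = unique-++⇒disjoint xs u z∈ z∈ys

-- Defs.filterᵇ is a copy of the library's filterᵇ; this transfers the library's filter lemmas.
filterᵇ-filter : (Q : A → Bool) (xs : List A) → filterᵇ Q xs ≡ Data.List.filterᵇ Q xs
filterᵇ-filter Q []       = refl
filterᵇ-filter Q (x ∷ xs) with Q x
... | true  = cong (x ∷_) (filterᵇ-filter Q xs)
... | false = filterᵇ-filter Q xs

∈-filterᵇ⁻ : (Q : A → Bool) {x : A} (xs : List A) → x ∈ filterᵇ Q xs → x ∈ xs × Q x ≡ true
∈-filterᵇ⁻ Q xs m with ∈-filter⁻ (T? ∘ Q) (subst (_ ∈_) (filterᵇ-filter Q xs) m)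
... | x∈xs , Qx = x∈xs , Equivalence.to T-≡ Qx

∈-filterᵇ⁺ : (Q : A → Bool) {x : A} {xs : List A} → x ∈ xs → Q x ≡ true → x ∈ filterᵇ Q xs
∈-filterᵇ⁺ Q {xs = xs} x∈xs Qx =
  subst (_ ∈_) (sym (filterᵇ-filter Q xs)) (∈-filter⁺ (T? ∘ Q) x∈xs (Equivalence.from T-≡ Qx))

unique-filterᵇ : (Q : A → Bool) {xs : List A} → Unique xs → Unique (filterᵇ Q xs)
unique-filterᵇ Q {xs} u = subst Unique (sym (filterᵇ-filter Q xs)) (Unique.filter⁺ (T? ∘ Q) u)

length-filterᵇ : (Q : A → Bool) (xs : List A) → length (filterᵇ Q xs) ≤ length xs
length-filterᵇ Q xs = subst (_≤ length xs) (cong length (sym (filterᵇ-filter Q xs))) (List.length-filter (T? ∘ Q) xs)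

filterᵇ-cong : {P Q : A → Bool} (xs : List A) → (∀ x → x ∈ xs → P x ≡ Q x) → filterᵇ P xs ≡ filterᵇ Q xs
filterᵇ-cong []       eq = refl
filterᵇ-cong {Q = Q} (x ∷ xs) eq rewrite eq x (here refl) with Q x
... | true  = cong (x ∷_) (filterᵇ-cong xs (λ y m → eq y (there m)))
... | false = filterᵇ-cong xs (λ y m → eq y (there m))

∈-insertions⁻ : {a : A} {y : List A} (w : List A) → y ∈ insertions a w →
  ∃₂ λ w₁ w₂ → w ≡ w₁ ++ w₂ × y ≡ w₁ ++ a ∷ w₂
∈-insertions⁻ []       (here refl) = [] , [] , refl , refl
∈-insertions⁻ (b ∷ bs) (here refl) = [] , b ∷ bs , refl , refl
∈-insertions⁻ (b ∷ bs) (there m) with ∈-map⁻ (b ∷_) m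
... | y , y∈ , refl with ∈-insertions⁻ bs y∈
...   | w₁ , w₂ , refl , refl = b ∷ w₁ , w₂ , refl , refl

∈-insertions⁺ : {a : A} (w₁ w₂ : List A) → w₁ ++ a ∷ w₂ ∈ insertions a (w₁ ++ w₂)
∈-insertions⁺ []       []      = here refl
∈-insertions⁺ []       (_ ∷ _) = here refl
∈-insertions⁺ (b ∷ w₁) w₂      = there (∈-map⁺ (b ∷_) (∈-insertions⁺ w₁ w₂))

∈-perms⁻ : {w : List A} (L : List A) → w ∈ perms L → w ↭ L
∈-perms⁻ []       (here refl) = ↭-refl
∈-perms⁻ (a ∷ as) m with ∈-concatMap⁻ (perms as) m
... | p , p∈ , w∈ with ∈-insertions⁻ p w∈
...   | w₁ , w₂ , refl , refl = ↭-trans (Perm.shift a w₁ w₂) (prep a (∈-perms⁻ as p∈))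

∈-perms⁺ : {w : List A} (L : List A) → w ↭ L → w ∈ perms L
∈-perms⁺ []       w↭ rewrite Perm.↭-empty-inv w↭ = here refl
∈-perms⁺ (a ∷ as) w↭ with ∈-∃++ (Perm.∈-resp-↭ (↭-sym w↭) (here refl))
... | w₁ , w₂ , refl = ∈-concatMap⁺ (∈-perms⁺ as (Perm.drop-mid w₁ [] w↭)) (∈-insertions⁺ w₁ w₂)

module _ (_≟_ : DecidableEquality A) where

  private
    remove : A → List A → List A
    remove a = filter (¬? ∘ (a ≟_))

    remove-insertion : {a : A} (w₁ w₂ : List A) → a ∉ w₁ ++ w₂ → remove a (w₁ ++ a ∷ w₂) ≡ w₁ ++ w₂
    remove-insertion {a} w₁ w₂ a∉ = begin
      remove a (w₁ ++ a ∷ w₂)            ≡⟨ List.filter-++ P? w₁ (a ∷ w₂) ⟩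
      remove a w₁ ++ remove a (a ∷ w₂)   ≡⟨ cong (remove a w₁ ++_) (List.filter-reject P? (_$ refl)) ⟩
      remove a w₁ ++ remove a w₂         ≡⟨ List.filter-++ P? w₁ w₂ ⟨
      remove a (w₁ ++ w₂)                ≡⟨ List.filter-all P? (All.¬Any⇒All¬ (w₁ ++ w₂) a∉) ⟩
      w₁ ++ w₂                           ∎
      where
      open ≡-Reasoning
      P? = ¬? ∘ (a ≟_)

  unique-insertions : {a : A} (w : List A) → a ∉ w → Unique (insertions a w)
  unique-insertions []       _  = [] ∷ []
  unique-insertions {a} (b ∷ bs) a∉ =
    All.¬Any⇒All¬ _ head∉ ∷ Unique.map⁺ (proj₂ ∘ List.∷-injective) (unique-insertions bs (a∉ ∘ there))
    where
    head∉ : a ∷ b ∷ bs ∉ map (b ∷_) (insertions a bs)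
    head∉ m with ∈-map⁻ (b ∷_) m
    ... | _ , _ , eq = a∉ (here (proj₁ (List.∷-injective eq)))

  unique-perms : (L : List A) → Unique L → Unique (perms L)
  unique-perms []       _          = [] ∷ []
  unique-perms (a ∷ as) (a∉ ∷ u) =
    unique-concatMap⁺ (remove a) (perms as) (unique-perms as u)
      (λ p p∈ → unique-insertions p (a∉p p∈))
      removes-a
    where
    a∉p : ∀ {p} → p ∈ perms as → a ∉ p
    a∉p p∈ a∈p = All.All¬⇒¬Any a∉ (Perm.∈-resp-↭ (∈-perms⁻ as p∈) a∈p)

    removes-a : ∀ p y → p ∈ perms as → y ∈ insertions a p → remove a y ≡ p
    removes-a p y p∈ y∈ with ∈-insertions⁻ p y∈
    ... | w₁ , w₂ , refl , refl = remove-insertion w₁ w₂ (a∉p p∈)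

  perms-↭ : {L₁ L₂ : List A} → Unique L₁ → L₁ ↭ L₂ → perms L₁ ↭ perms L₂
  perms-↭ {L₁} {L₂} u L₁↭L₂ =
    unique∧set⇒↭ (unique-perms L₁ u) (unique-perms L₂ (Unique-resp-↭ L₁↭L₂ u))
    (mk⇔ (λ m → ∈-perms⁺ L₂ (↭-trans (∈-perms⁻ L₁ m) L₁↭L₂))
         (λ m → ∈-perms⁺ L₁ (↭-trans (∈-perms⁻ L₂ m) (↭-sym L₁↭L₂))))

insertions-map : (g : A → B) (a : A) (w : List A) → insertions (g a) (map g w) ≡ map (map g) (insertions a w)
insertions-map g a []       = refl
insertions-map g a (b ∷ bs) = cong ((g a ∷ g b ∷ map g bs) ∷_) (begin
  map (g b ∷_) (insertions (g a) (map g bs))    ≡⟨ cong (map (g b ∷_)) (insertions-map g a bs) ⟩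
  map (g b ∷_) (map (map g) (insertions a bs))  ≡⟨ List.map-∘ (insertions a bs) ⟨
  map (map g ∘ (b ∷_)) (insertions a bs)        ≡⟨ List.map-∘ (insertions a bs) ⟩
  map (map g) (map (b ∷_) (insertions a bs))    ∎)
  where open ≡-Reasoning

perms-map : (g : A → B) (L : List A) → perms (map g L) ≡ map (map g) (perms L)
perms-map g []       = refl
perms-map g (a ∷ as) = begin
  concatMap (insertions (g a)) (perms (map g as))        ≡⟨ cong (concatMap (insertions (g a))) (perms-map g as) ⟩
  concatMap (insertions (g a)) (map (map g) (perms as))  ≡⟨ List.concatMap-map (insertions (g a)) (map g) (perms as) ⟩
  concatMap (insertions (g a) ∘ map g) (perms as)        ≡⟨ List.concatMap-cong (insertions-map g a) (perms as) ⟩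
  concatMap (map (map g) ∘ insertions a) (perms as)      ≡⟨ List.map-concatMap (map g) (insertions a) (perms as) ⟨
  map (map g) (concatMap (insertions a) (perms as))      ∎
  where open ≡-Reasoning

_∈ᵇ_ : ℤ → List ℤ → Bool
x ∈ᵇ X = does (x ∈? X)

abs : ℤ → ℤ
abs x = + ∣ x ∣

abs-cases : (x : ℤ) → x ≡ abs x ⊎ x ≡ - abs x
abs-cases (+ n)    = inj₁ refl
abs-cases -[1+ n ] = inj₂ refl

abs-neg : (x : ℤ) → abs (- x) ≡ abs x
abs-neg x = cong +_ (ℤ.∣-i∣≡∣i∣ x)

abs-pos : {x : ℤ} → 0ℤ ℤ.< x → abs x ≡ x
abs-pos {+ n} _ = refl

map-abs-pos : {L : List ℤ} → All (0ℤ ℤ.<_) L → map abs L ≡ L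
map-abs-pos []         = refl
map-abs-pos (x>0 ∷ L>0) = cong₂ _∷_ (abs-pos x>0) (map-abs-pos L>0)

pos≢neg : {a b : ℤ} → 0ℤ ℤ.< a → 0ℤ ℤ.< b → b ≢ - a
pos≢neg {+ zero}  (+<+ ())
pos≢neg {+ suc _} {+ zero}  _ (+<+ ())
pos≢neg {+ suc _} {+ suc _} _ _ ()

signedPerms : List ℤ → List (List ℤ)
signedPerms L = concatMap signings (perms L)

∈-signings⁻ : {y : List ℤ} (p : List ℤ) → y ∈ signings p → map abs y ≡ map abs p
∈-signings⁻ []       (here refl) = refl
∈-signings⁻ (a ∷ as) m with ∈-concatMap⁻ (signings as) m
... | s , s∈ , here refl         = cong (abs a ∷_) (∈-signings⁻ as s∈)
... | s , s∈ , there (here refl) = cong₂ _∷_ (abs-neg a) (∈-signings⁻ as s∈)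

∈-signings⁺ : (y : List ℤ) → y ∈ signings (map abs y)
∈-signings⁺ []       = here refl
∈-signings⁺ (c ∷ ys) with abs-cases c
... | inj₁ eq = ∈-concatMap⁺ (∈-signings⁺ ys) (here (cong (_∷ ys) eq))
... | inj₂ eq = ∈-concatMap⁺ (∈-signings⁺ ys) (there (here (cong (_∷ ys) eq)))

∈-signings-abs : {L s : List ℤ} → All (0ℤ ℤ.<_) L → s ∈ signings L → map abs s ≡ L
∈-signings-abs {L} L>0 s∈ = trans (∈-signings⁻ L s∈) (map-abs-pos L>0)

unique-signings : {p : List ℤ} → All (0ℤ ℤ.<_) p → Unique (signings p)
unique-signings []                   = [] ∷ []
unique-signings {a ∷ as} (a>0 ∷ as>0) =
  unique-concatMap⁺ (drop 1) (signings as) (unique-signings as>0)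
    (λ _ _ → ((pos≢neg a>0 a>0 ∘ proj₁ ∘ List.∷-injective) ∷ []) ∷ [] ∷ [])
    (λ { _ _ _ (here refl) → refl ; _ _ _ (there (here refl)) → refl })

∈-perms-All : {P : ℤ → Set} {p L : List ℤ} → All P L → p ∈ perms L → All P p
∈-perms-All {L = L} PL p∈ = Perm.All-resp-↭ (↭-sym (∈-perms⁻ L p∈)) PL

∈-signedPerms⁻ : {w L : List ℤ} → All (0ℤ ℤ.<_) L → w ∈ signedPerms L → map abs w ↭ L
∈-signedPerms⁻ {w} {L} L>0 m with ∈-concatMap⁻ (perms L) m
... | p , p∈ , w∈ =
  subst (_↭ L) (sym (∈-signings-abs (∈-perms-All L>0 p∈) w∈)) (∈-perms⁻ L p∈)

∈-signedPerms⁺ : {w : List ℤ} (L : List ℤ) → map abs w ↭ L → w ∈ signedPerms L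
∈-signedPerms⁺ {w} L w↭ = ∈-concatMap⁺ (∈-perms⁺ L w↭) (∈-signings⁺ w)

∈-signedPerms-abs : {w L : List ℤ} {x : ℤ} → All (0ℤ ℤ.<_) L → w ∈ signedPerms L → x ∈ w → abs x ∈ L
∈-signedPerms-abs L>0 w∈ x∈ = Perm.∈-resp-↭ (∈-signedPerms⁻ L>0 w∈) (∈-map⁺ abs x∈)

unique-signedPerms : {L : List ℤ} → Unique L → All (0ℤ ℤ.<_) L → Unique (signedPerms L)
unique-signedPerms {L} u L>0 = unique-concatMap⁺ (map abs) (perms L) (unique-perms ℤ._≟_ L u)
  (λ p p∈ → unique-signings (∈-perms-All L>0 p∈))
  (λ p y p∈ y∈ → ∈-signings-abs (∈-perms-All L>0 p∈) y∈)

signedPerms-↭ : {L₁ L₂ : List ℤ} → Unique L₁ → All (0ℤ ℤ.<_) L₁ → L₁ ↭ L₂ →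
  signedPerms L₁ ↭ signedPerms L₂
signedPerms-↭ {L₁} {L₂} u L₁>0 L₁↭L₂ =
  unique∧set⇒↭ (unique-signedPerms u L₁>0) (unique-signedPerms (Unique-resp-↭ L₁↭L₂ u) L₂>0)
    (mk⇔ (λ m → ∈-signedPerms⁺ L₂ (↭-trans (∈-signedPerms⁻ L₁>0 m) L₁↭L₂))
         (λ m → ∈-signedPerms⁺ L₁ (↭-trans (∈-signedPerms⁻ L₂>0 m) (↭-sym L₁↭L₂))))
  where
  L₂>0 = Perm.All-resp-↭ L₁↭L₂ L₁>0

-- Order-invariant statistics

StrictlyMonotoneOn : (ℤ → ℤ) → List ℤ → Set
StrictlyMonotoneOn g w = ∀ {a b} → a ∈ w → b ∈ w → a ℤ.< b → g a ℤ.< g b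

OrderInvariant : (List ℤ → ℕ) → Set
OrderInvariant st = ∀ g w → StrictlyMonotoneOn g w → st (map g w) ≡ st w

monotone-does-< : ∀ {g w} → StrictlyMonotoneOn g w → ∀ {a b} → a ∈ w → b ∈ w →
  does (b ℤ.<? a) ≡ does (g b ℤ.<? g a)
monotone-does-< {g} mono {a} {b} a∈ b∈ = does-⇔ (mk⇔ (mono b∈ a∈) reflect) (b ℤ.<? a) (g b ℤ.<? g a)
  where
  reflect : g b ℤ.< g a → b ℤ.< a
  reflect gb<ga with ℤ.<-cmp b a
  ... | tri< b<a _ _  = b<a
  ... | tri≈ _ refl _ = ⊥-elim (ℤ.<-irrefl refl gb<ga)
  ... | tri> _ _ a<b  = ⊥-elim (ℤ.<-asym gb<ga (mono a∈ b∈ a<b))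

desA-orderInvariant : OrderInvariant desA
desA-orderInvariant g []          _    = refl
desA-orderInvariant g (a ∷ [])    _    = refl
desA-orderInvariant g (a ∷ b ∷ r) mono =
  cong₂ _+_ (cong (λ t → if t then 1 else 0) (sym (monotone-does-< mono (here refl) (there (here refl)))))
            (desA-orderInvariant g (b ∷ r) (λ x∈ y∈ → mono (there x∈) (there y∈)))

relabel : List ℤ → List ℤ → ℤ → ℤ
relabel (a ∷ as) (b ∷ bs) x = if does (x ℤ.≟ a) then b else relabel as bs x
relabel _        _        x = x

relabel-head : (a : ℤ) (as : List ℤ) (b : ℤ) (bs : List ℤ) → relabel (a ∷ as) (b ∷ bs) a ≡ b
relabel-head a as b bs rewrite dec-true (a ℤ.≟ a) refl = refl

relabel-tail : {x : ℤ} (a : ℤ) (as : List ℤ) (b : ℤ) (bs : List ℤ) → x ≢ a →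
  relabel (a ∷ as) (b ∷ bs) x ≡ relabel as bs x
relabel-tail {x} a as b bs x≢a rewrite dec-false (x ℤ.≟ a) x≢a = refl

map-relabel : {T₁ T₂ : List ℤ} → Unique T₁ → length T₁ ≡ length T₂ → map (relabel T₁ T₂) T₁ ≡ T₂
map-relabel {[]}     {[]}     _          _  = refl
map-relabel {a ∷ as} {b ∷ bs} (a∉ ∷ u) eq =
  cong₂ _∷_ (relabel-head a as b bs)
    (trans (List.map-cong-local (All.map (λ a≢x → relabel-tail a as b bs (a≢x ∘ sym)) a∉))
           (map-relabel u (Nat.suc-injective eq)))

relabel-∈ : {x : ℤ} (T₁ T₂ : List ℤ) → x ∈ T₁ → length T₁ ≡ length T₂ → relabel T₁ T₂ x ∈ T₂
relabel-∈ (a ∷ as) (b ∷ bs) (here refl) _ rewrite relabel-head a as b bs = here refl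
relabel-∈ {x} (a ∷ as) (b ∷ bs) (there x∈) eq with x ℤ.≟ a
... | yes _ = here refl
... | no  _ = there (relabel-∈ as bs x∈ (Nat.suc-injective eq))

relabel-mono : (T₁ T₂ : List ℤ) → AllPairs ℤ._<_ T₁ → AllPairs ℤ._<_ T₂ → length T₁ ≡ length T₂ →
  StrictlyMonotoneOn (relabel T₁ T₂) T₁
relabel-mono (a ∷ as) (b ∷ bs) _ _ _ (here refl) (here refl) a<a = ⊥-elim (ℤ.<-irrefl refl a<a)
relabel-mono (a ∷ as) (b ∷ bs) (a< ∷ _) (b< ∷ _) eq {b = y} (here refl) (there y∈) _
  rewrite relabel-head a as b bs | relabel-tail {y} a as b bs (ℤ.<⇒≢ (All.lookup a< y∈) ∘ sym) =
  All.lookup b< (relabel-∈ as bs y∈ (Nat.suc-injective eq))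
relabel-mono (a ∷ as) (b ∷ bs) (a< ∷ _) _ _ (there x∈) (here refl) x<a = ⊥-elim (ℤ.<-asym x<a (All.lookup a< x∈))
relabel-mono (a ∷ as) (b ∷ bs) (a< ∷ s₁) (_ ∷ s₂) eq {x} {y} (there x∈) (there y∈) x<y
  rewrite relabel-tail {x} a as b bs (ℤ.<⇒≢ (All.lookup a< x∈) ∘ sym)
        | relabel-tail {y} a as b bs (ℤ.<⇒≢ (All.lookup a< y∈) ∘ sym) =
  relabel-mono as bs s₁ s₂ (Nat.suc-injective eq) x∈ y∈ x<y

range-sorted : (n : ℕ) → AllPairs ℤ._<_ (range n)
range-sorted n = AllPairs.map⁺ (AllPairs.applyUpTo⁺₁ (λ i → i) n (λ i<j _ → +<+ (s<s i<j)))

unique-range : (n : ℕ) → Unique (range n)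
unique-range n = AllPairs.map ℤ.<⇒≢ (range-sorted n)

length-range : (n : ℕ) → length (range n) ≡ n
length-range n = trans (List.length-map _ (upTo n)) (List.length-applyUpTo (λ i → i) n)

range-pos : (n : ℕ) → All (0ℤ ℤ.<_) (range n)
range-pos n = All.map⁺ (All.applyUpTo⁺₂ (λ i → i) n (λ _ → +<+ z<s))

sort-strictlySorted : {L : List ℤ} → Unique L → AllPairs ℤ._<_ (sort L)
sort-strictlySorted {L} u = AllPairs.zipWith (λ (x≤y , x≢y) → ℤ.≤∧≢⇒< x≤y x≢y)
  (Linked.Linked⇒AllPairs ℤ.≤-trans (sort-↗ L) , Unique-resp-↭ (↭-sym (sort-↭ L)) u)

-- Relabel Sym k along the order isomorphism from range k onto the sorted copy of L.
genPoly-perms : (st : List ℤ → ℕ) → OrderInvariant st → {L : List ℤ} → Unique L → (j : ℕ) →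
  genPoly (perms L) st j ≡ genPoly (Sym (length L)) st j
genPoly-perms st inv {L} u j = begin
  count P (perms L)                    ≡⟨ count-↭ P (perms-↭ ℤ._≟_ u (↭-sym (sort-↭ L))) ⟩
  count P (perms S)                    ≡⟨ cong (count P ∘ perms) (map-relabel (unique-range k) R≡S) ⟨
  count P (perms (map r R))            ≡⟨ cong (count P) (perms-map r R) ⟩
  count P (map (map r) (perms R))      ≡⟨ count-map P (map r) (perms R) ⟩
  count (λ w → P (map r w)) (perms R)  ≡⟨ count-cong (perms R) (λ w w∈ → cong (_≡ᵇ j) (inv r w (mono w w∈))) ⟩
  count P (perms R)                    ∎
  where
  open ≡-Reasoning
  P = λ w → st w ≡ᵇ j
  S = sort L
  k = length L
  R = range k
  r = relabel R S
  R≡S : length R ≡ length S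
  R≡S = trans (length-range k) (sym (Perm.↭-length (sort-↭ L)))
  mono : ∀ w → w ∈ perms R → StrictlyMonotoneOn r w
  mono w w∈ a∈ b∈ = relabel-mono R S (range-sorted k) (sort-strictlySorted u) R≡S
    (Perm.∈-resp-↭ (∈-perms⁻ R w∈) a∈) (Perm.∈-resp-↭ (∈-perms⁻ R w∈) b∈)

-- Choosing the signs first

signingOf : List ℤ → List ℤ → List ℤ
signingOf L y = map (λ a → if a ∈ᵇ y then a else - a) L

signingOf-cong : (L : List ℤ) {y y′ : List ℤ} →
  (∀ {a} → a ∈ L → a ∈ y → a ∈ y′) → (∀ {a} → a ∈ L → a ∈ y′ → a ∈ y) → signingOf L y ≡ signingOf L y′
signingOf-cong L to from = List.map-cong-local (All.tabulate λ {a} a∈ →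
  cong (λ b → if b then a else - a) (does-⇔ (mk⇔ (to a∈) (from a∈)) (a ∈? _) (a ∈? _)))

signingOf-signings : {L s : List ℤ} → All (0ℤ ℤ.<_) L → Unique L → s ∈ signings L → signingOf L s ≡ s
signingOf-signings {[]}     _            _          (here refl) = refl
signingOf-signings {a ∷ as} (a>0 ∷ as>0) (a∉ ∷ u) s∈ with ∈-concatMap⁻ (signings as) s∈
... | s , s∈′ , here refl
  = cong₂ _∷_ (cong (λ b → if b then a else - a) (dec-true (a ∈? a ∷ s) (here refl)))
              (trans (signingOf-cong as drop-head (λ _ → there)) IH)
  where
  IH = signingOf-signings as>0 u s∈′
  drop-head : ∀ {b} → b ∈ as → b ∈ a ∷ s → b ∈ s
  drop-head b∈ (here refl) = ⊥-elim (All.All¬⇒¬Any a∉ b∈)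
  drop-head _  (there b∈s) = b∈s
... | s , s∈′ , there (here refl)
  = cong₂ _∷_ (cong (λ b → if b then a else - a) (dec-false (a ∈? - a ∷ s) a∉-a∷s))
              (trans (signingOf-cong as drop-head (λ _ → there)) IH)
  where
  IH = signingOf-signings as>0 u s∈′
  a∉-a∷s : a ∉ - a ∷ s
  a∉-a∷s (here a≡-a) = pos≢neg a>0 a>0 a≡-a
  a∉-a∷s (there a∈s) = All.All¬⇒¬Any a∉
    (subst (a ∈_) (∈-signings-abs as>0 s∈′) (subst (_∈ map abs s) (abs-pos a>0) (∈-map⁺ abs a∈s)))
  drop-head : ∀ {b} → b ∈ as → b ∈ - a ∷ s → b ∈ s
  drop-head b∈ (here b≡-a) = ⊥-elim (pos≢neg a>0 (All.lookup as>0 b∈) b≡-a)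
  drop-head _  (there b∈s) = b∈s

signFirst : List ℤ → List (List ℤ)
signFirst L = concatMap perms (signings L)

module SignFirst {L : List ℤ} (L>0 : All (0ℤ ℤ.<_) L) (unique-L : Unique L) where

  unique-signing : ∀ {s} → s ∈ signings L → Unique s
  unique-signing s∈ = Unique.map⁻ (subst Unique (sym (∈-signings-abs L>0 s∈)) unique-L)

  unique-signFirst : Unique (signFirst L)
  unique-signFirst = unique-concatMap⁺ (signingOf L) (signings L) (unique-signings L>0)
    (λ s s∈ → unique-perms ℤ._≟_ s (unique-signing s∈)) recovers
    where
    recovers : ∀ s y → s ∈ signings L → y ∈ perms s → signingOf L y ≡ s
    recovers s y s∈ y∈ = trans (signingOf-cong L (λ _ → Perm.∈-resp-↭ (∈-perms⁻ s y∈))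
                                                (λ _ → Perm.∈-resp-↭ (↭-sym (∈-perms⁻ s y∈))))
                               (signingOf-signings L>0 unique-L s∈)

  signFirst⊆signedPerms : ∀ {w} → w ∈ signFirst L → w ∈ signedPerms L
  signFirst⊆signedPerms w∈ with ∈-concatMap⁻ (signings L) w∈
  ... | s , s∈ , w∈s =
    ∈-signedPerms⁺ L (subst (_ ↭_) (∈-signings-abs L>0 s∈) (Perm.map⁺ abs (∈-perms⁻ s w∈s)))

  module _ {w : List ℤ} (w∈ : w ∈ signedPerms L) where

    private
      abs-w : map abs w ↭ L
      abs-w = ∈-signedPerms⁻ L>0 w∈
      unique-abs-w : Unique (map abs w)
      unique-abs-w = Unique-resp-↭ (↭-sym abs-w) unique-L

    signingOf-signedPerms : signingOf L w ∈ signings L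
    signingOf-signedPerms = subst (λ t → signingOf L w ∈ signings t) abs-signingOf (∈-signings⁺ (signingOf L w))
      where
      abs-sign : ∀ {a} → a ∈ L → abs (if a ∈ᵇ w then a else - a) ≡ a
      abs-sign {a} a∈ with a ∈ᵇ w
      ... | true  = abs-pos (All.lookup L>0 a∈)
      ... | false = trans (abs-neg a) (abs-pos (All.lookup L>0 a∈))
      abs-signingOf : map abs (signingOf L w) ≡ L
      abs-signingOf = trans (sym (List.map-∘ L)) (trans (List.map-cong-local (All.tabulate abs-sign)) (List.map-id L))

    ↭-signingOf : w ↭ signingOf L w
    ↭-signingOf = unique∧set⇒↭ (Unique.map⁻ unique-abs-w) (unique-signing signingOf-signedPerms) (mk⇔ to from)
      where
      to : ∀ {x} → x ∈ w → x ∈ signingOf L w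
      to {x} x∈ = subst (_∈ signingOf L w) sign-abs (∈-map⁺ _ (∈-signedPerms-abs L>0 w∈ x∈))
        where
        sign : Bool → ℤ
        sign b = if b then abs x else - abs x
        sign-abs : sign (abs x ∈ᵇ w) ≡ x
        sign-abs with abs-cases x
        ... | inj₁ x≡ = trans (cong sign (dec-true (abs x ∈? w) (subst (_∈ w) x≡ x∈))) (sym x≡)
        ... | inj₂ x≡ = trans (cong sign (dec-false (abs x ∈? w) abs-x∉w)) (sym x≡)
          where
          abs-x>0 = All.lookup L>0 (∈-signedPerms-abs L>0 w∈ x∈)
          abs-x∉w : abs x ∉ w
          abs-x∉w abs-x∈ = pos≢neg abs-x>0 abs-x>0
                                   (trans (unique-map⇒injective w unique-abs-w abs-x∈ x∈ refl) x≡)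
      from : ∀ {x} → x ∈ signingOf L w → x ∈ w
      from x∈ with ∈-map⁻ _ x∈
      ... | a , a∈ , refl with a ∈? w
      ...   | yes a∈w = a∈w
      ...   | no  a∉w with ∈-map⁻ abs (Perm.∈-resp-↭ (↭-sym abs-w) a∈)
      ...     | y , y∈ , refl with abs-cases y
      ...       | inj₁ y≡ = ⊥-elim (a∉w (subst (_∈ w) y≡ y∈))
      ...       | inj₂ y≡ = subst (_∈ w) y≡ y∈

  signedPerms⊆signFirst : ∀ {w} → w ∈ signedPerms L → w ∈ signFirst L
  signedPerms⊆signFirst w∈ = ∈-concatMap⁺ (signingOf-signedPerms w∈) (∈-perms⁺ _ (↭-signingOf w∈))

  signedPerms↭signFirst : signedPerms L ↭ signFirst L
  signedPerms↭signFirst = unique∧set⇒↭ (unique-signedPerms unique-L L>0) unique-signFirst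
    (mk⇔ signedPerms⊆signFirst signFirst⊆signedPerms)

length-signings : (L : List ℤ) → length (signings L) ≡ 2 ^ length L
length-signings []       = refl
length-signings (a ∷ as) = begin
  length (signings (a ∷ as))               ≡⟨ count-true (signings (a ∷ as)) ⟨
  count (λ _ → true) (signings (a ∷ as))   ≡⟨ count-concatMap-const _ _ (signings as) 2 (λ _ _ → refl) ⟩
  length (signings as) * 2                 ≡⟨ cong (_* 2) (length-signings as) ⟩
  2 ^ length as * 2                        ≡⟨ Nat.*-comm (2 ^ length as) 2 ⟩
  2 ^ length (a ∷ as)                      ∎
  where open ≡-Reasoning

genPoly-signedPerms : {L : List ℤ} → All (0ℤ ℤ.<_) L → Unique L →
  ∀ j → genPoly (signedPerms L) desA j ≡ 2 ^ length L * genPoly (Sym (length L)) desA j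
genPoly-signedPerms {L} L>0 unique-L j = begin
  count Q (signedPerms L)                                  ≡⟨ count-↭ Q signedPerms↭signFirst ⟩
  count Q (signFirst L)                                    ≡⟨ count-concatMap-const Q perms (signings L) _ perms-count ⟩
  length (signings L) * genPoly (Sym (length L)) desA j    ≡⟨ cong (_* genPoly (Sym (length L)) desA j) (length-signings L) ⟩
  2 ^ length L * genPoly (Sym (length L)) desA j           ∎
  where
  open ≡-Reasoning
  open SignFirst L>0 unique-L
  Q = λ w → desA w ≡ᵇ j
  perms-count : ∀ s → s ∈ signings L → count Q (perms s) ≡ genPoly (Sym (length L)) desA j
  perms-count s s∈ = trans (genPoly-perms desA desA-orderInvariant (unique-signing s∈) j)
    (cong (λ l → genPoly (Sym l) desA j) (trans (sym (List.length-map abs s)) (cong length (∈-signings-abs L>0 s∈))))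

data Sign : Set where
  neg pos : Sign

hasSign : Sign → ℤ → Bool
hasSign neg x = does (x ℤ.<? 0ℤ)
hasSign pos x = does (0ℤ ℤ.<? x)

startsWith : Sign → List ℤ → Bool
startsWith σ []      = false
startsWith σ (a ∷ _) = hasSign σ a

tailWords : Sign → List ℤ → List (List ℤ)
tailWords σ T = filterᵇ (not ∘ startsWith σ) (signedPerms T)

∈-tailWords-signedPerms : {σ : Sign} {T v : List ℤ} → v ∈ tailWords σ T → v ∈ signedPerms T
∈-tailWords-signedPerms {σ} {T} v∈ = proj₁ (∈-filterᵇ⁻ (not ∘ startsWith σ) (signedPerms T) v∈)

tailWords-startsWith : {σ : Sign} {v T : List ℤ} → v ∈ tailWords σ T → startsWith σ v ≡ false
tailWords-startsWith {σ} {v} {T} v∈ = not-injective (proj₂ (∈-filterᵇ⁻ (not ∘ startsWith σ) (signedPerms T) v∈))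

signings-map : (g : ℤ → ℤ) (p : List ℤ) → (∀ a → a ∈ p → g (- a) ≡ - g a) →
  signings (map g p) ≡ map (map g) (signings p)
signings-map g []       _   = refl
signings-map g (a ∷ as) odd = begin
  concatMap F (signings (map g as))                  ≡⟨ cong (concatMap F) (signings-map g as (λ x m → odd x (there m))) ⟩
  concatMap F (map (map g) (signings as))            ≡⟨ List.concatMap-map F (map g) (signings as) ⟩
  concatMap (F ∘ map g) (signings as)                ≡⟨ List.concatMap-cong odd-head (signings as) ⟩
  concatMap (map (map g) ∘ signs a) (signings as)    ≡⟨ List.map-concatMap (map g) (signs a) (signings as) ⟨
  map (map g) (signings (a ∷ as))                    ∎
  where
  open ≡-Reasoning
  signs : ℤ → List ℤ → List (List ℤ)
  signs c s = (c ∷ s) ∷ (- c ∷ s) ∷ []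
  F = signs (g a)
  odd-head : ∀ s → F (map g s) ≡ map (map g) (signs a s)
  odd-head s = cong (λ t → (g a ∷ map g s) ∷ (t ∷ map g s) ∷ []) (sym (odd a (here refl)))

signedPerms-map : (g : ℤ → ℤ) (L : List ℤ) → (∀ a → a ∈ L → g (- a) ≡ - g a) →
  signedPerms (map g L) ≡ map (map g) (signedPerms L)
signedPerms-map g L odd = begin
  concatMap signings (perms (map g L))               ≡⟨ cong (concatMap signings) (perms-map g L) ⟩
  concatMap signings (map (map g) (perms L))         ≡⟨ List.concatMap-map signings (map g) (perms L) ⟩
  concatMap (signings ∘ map g) (perms L)             ≡⟨ cong concat (List.map-cong-local (All.tabulate odd-on)) ⟩
  concatMap (map (map g) ∘ signings) (perms L)       ≡⟨ List.map-concatMap (map g) signings (perms L) ⟨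
  map (map g) (signedPerms L)                        ∎
  where
  open ≡-Reasoning
  odd-on : ∀ {p} → p ∈ perms L → signings (map g p) ≡ map (map g) (signings p)
  odd-on p∈ = signings-map g _ (λ a a∈ → odd a (Perm.∈-resp-↭ (∈-perms⁻ L p∈) a∈))

-- Extends relabel R S to the signed letters ±R by making it odd.
module SignedRelabel {R S : List ℤ} (R-sorted : AllPairs ℤ._<_ R) (S-sorted : AllPairs ℤ._<_ S)
  (R>0 : All (0ℤ ℤ.<_) R) (S>0 : All (0ℤ ℤ.<_) S) (R≡S : length R ≡ length S) where

  r : ℤ → ℤ
  r = relabel R S

  g : ℤ → ℤ
  g x = if does (x ℤ.<? 0ℤ) then - r (- x) else r x

  r>0 : ∀ {y} → y ∈ R → 0ℤ ℤ.< r y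
  r>0 y∈ = All.lookup S>0 (relabel-∈ R S y∈ R≡S)

  data Letter (x : ℤ) : Set where
    positive : x ∈ R → g x ≡ r x → 0ℤ ℤ.< x → Letter x
    negative : - x ∈ R → g x ≡ - r (- x) → x ℤ.< 0ℤ → Letter x

  letter : (x : ℤ) → abs x ∈ R → Letter x
  letter (+ n)    x∈ with + n ℤ.<? 0ℤ
  ... | yes (+<+ ())
  ... | no  _ = positive x∈ refl (All.lookup R>0 x∈)
  letter -[1+ n ] x∈ with -[1+ n ] ℤ.<? 0ℤ
  ... | yes _    = negative x∈ refl -<+
  ... | no  ¬x<0 = ⊥-elim (¬x<0 -<+)

  g-on-R : ∀ {x} → x ∈ R → g x ≡ r x
  g-on-R x∈ rewrite dec-false (_ ℤ.<? 0ℤ) (ℤ.<-asym (All.lookup R>0 x∈)) = refl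

  g-odd : ∀ a → a ∈ R → g (- a) ≡ - g a
  g-odd a a∈ with All.lookup R>0 a∈
  ... | +<+ {n = suc n} _ = refl

  g-mono : ∀ {a b} → abs a ∈ R → abs b ∈ R → a ℤ.< b → g a ℤ.< g b
  g-mono {a} {b} a∈ b∈ a<b with letter a a∈ | letter b b∈
  ... | positive a∈R ga _ | positive b∈R gb _ rewrite ga | gb = relabel-mono R S R-sorted S-sorted R≡S a∈R b∈R a<b
  ... | negative a∈R ga _ | positive b∈R gb _ rewrite ga | gb = ℤ.<-trans (ℤ.neg-mono-< (r>0 a∈R)) (r>0 b∈R)
  ... | positive _ _ a>0  | negative _ _ b<0 = ⊥-elim (ℤ.<-asym (ℤ.<-trans a<b b<0) a>0)
  ... | negative a∈R ga _ | negative b∈R gb _ rewrite ga | gb =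
    ℤ.neg-mono-< (relabel-mono R S R-sorted S-sorted R≡S b∈R a∈R (ℤ.neg-mono-< a<b))

  hasSign-g : (σ : Sign) (x : ℤ) → abs x ∈ R → hasSign σ (g x) ≡ hasSign σ x
  hasSign-g σ x x∈ with letter x x∈
  hasSign-g neg x x∈ | positive x∈R gx x>0 rewrite gx =
    trans (dec-false (_ ℤ.<? 0ℤ) (ℤ.<-asym (r>0 x∈R))) (sym (dec-false (_ ℤ.<? 0ℤ) (ℤ.<-asym x>0)))
  hasSign-g neg x x∈ | negative x∈R gx x<0 rewrite gx =
    trans (dec-true (_ ℤ.<? 0ℤ) (ℤ.neg-mono-< (r>0 x∈R))) (sym (dec-true (_ ℤ.<? 0ℤ) x<0))
  hasSign-g pos x x∈ | positive x∈R gx x>0 rewrite gx =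
    trans (dec-true (0ℤ ℤ.<? _) (r>0 x∈R)) (sym (dec-true (0ℤ ℤ.<? _) x>0))
  hasSign-g pos x x∈ | negative x∈R gx x<0 rewrite gx =
    trans (dec-false (0ℤ ℤ.<? _) (ℤ.<-asym (ℤ.neg-mono-< (r>0 x∈R)))) (sym (dec-false (0ℤ ℤ.<? _) (ℤ.<-asym x<0)))

  startsWith-g : (σ : Sign) (w : List ℤ) → (∀ {x} → x ∈ w → abs x ∈ R) →
    startsWith σ (map g w) ≡ startsWith σ w
  startsWith-g σ []      _  = refl
  startsWith-g σ (x ∷ w) in-R = hasSign-g σ x (in-R (here refl))

  map-g-R : map g R ≡ S
  map-g-R = trans (List.map-cong-local (All.tabulate g-on-R)) (map-relabel (AllPairs.map ℤ.<⇒≢ R-sorted) R≡S)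

genPoly-tailWords : (σ : Sign) (st : List ℤ → ℕ) → OrderInvariant st →
  {T : List ℤ} → Unique T → All (0ℤ ℤ.<_) T → (j : ℕ) →
  genPoly (tailWords σ T) st j ≡ genPoly (tailWords σ (range (length T))) st j
genPoly-tailWords σ st inv {T} u T>0 j = begin
  count Q (filterᵇ ok (signedPerms T))        ≡⟨ count-filterᵇ Q ok (signedPerms T) ⟩
  count okQ (signedPerms T)                   ≡⟨ count-↭ okQ (signedPerms-↭ u T>0 (↭-sym (sort-↭ T))) ⟩
  count okQ (signedPerms S)                   ≡⟨ cong (count okQ ∘ signedPerms) map-g-R ⟨
  count okQ (signedPerms (map g R))           ≡⟨ cong (count okQ) (signedPerms-map g R g-odd) ⟩
  count okQ (map (map g) (signedPerms R))     ≡⟨ count-map okQ (map g) (signedPerms R) ⟩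
  count (okQ ∘ map g) (signedPerms R)         ≡⟨ count-cong (signedPerms R) okQ-g ⟩
  count okQ (signedPerms R)                   ≡⟨ count-filterᵇ Q ok (signedPerms R) ⟨
  count Q (filterᵇ ok (signedPerms R))        ∎
  where
  open ≡-Reasoning
  ok = not ∘ startsWith σ
  Q = λ w → st w ≡ᵇ j
  okQ = λ w → ok w ∧ Q w
  k = length T
  R = range k
  S = sort T
  open SignedRelabel (range-sorted k) (sort-strictlySorted u) (range-pos k)
    (Perm.All-resp-↭ (↭-sym (sort-↭ T)) T>0) (trans (length-range k) (sym (Perm.↭-length (sort-↭ T))))
  okQ-g : ∀ w → w ∈ signedPerms R → okQ (map g w) ≡ okQ w
  okQ-g w w∈ = cong₂ _∧_ (cong not (startsWith-g σ w in-R))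
                         (cong (_≡ᵇ j) (inv g w (λ a∈ b∈ → g-mono (in-R a∈) (in-R b∈))))
    where
    in-R : ∀ {x} → x ∈ w → abs x ∈ R
    in-R = ∈-signedPerms-abs (range-pos k) w∈

-- Binomial convolution

sumTo-cong : (j : ℕ) {f g : ℕ → ℕ} → (∀ i → f i ≡ g i) → sumTo j f ≡ sumTo j g
sumTo-cong zero    eq = eq 0
sumTo-cong (suc j) eq = cong₂ _+_ (sumTo-cong j eq) (eq (suc j))

sumTo-+ : (j : ℕ) (f g : ℕ → ℕ) → sumTo j (λ i → f i + g i) ≡ sumTo j f + sumTo j g
sumTo-+ zero    f g = refl
sumTo-+ (suc j) f g = trans (cong (_+ (f (suc j) + g (suc j))) (sumTo-+ j f g))
                            (interchange (sumTo j f) (sumTo j g) (f (suc j)) (g (suc j)))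

sumTo-zero : (j : ℕ) (f : ℕ → ℕ) → (∀ i → i ≤ j → f i ≡ 0) → sumTo j f ≡ 0
sumTo-zero zero    f vanish = vanish 0 ℕ.z≤n
sumTo-zero (suc j) f vanish =
  cong₂ _+_ (sumTo-zero j f (λ i i≤j → vanish i (Nat.m≤n⇒m≤1+n i≤j))) (vanish (suc j) Nat.≤-refl)

δ : ℕ → ℕ → ℕ
δ c i = if c ≡ᵇ i then 1 else 0

sumTo-δ-beyond : {c j : ℕ} (G : ℕ → ℕ) → j ℕ.< c → sumTo j (λ i → δ c i * G i) ≡ 0
sumTo-δ-beyond {c} {j} G j<c = sumTo-zero j _ (λ i i≤j →
  cong (λ b → (if b then 1 else 0) * G i) (dec-false (c ℕ.≟ i) (Nat.>⇒≢ (Nat.≤-<-trans i≤j j<c))))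

sumTo-δ : {c j : ℕ} (G : ℕ → ℕ) → c ≤ j → sumTo j (λ i → δ c i * G i) ≡ G c
sumTo-δ {c} {zero}  G ℕ.z≤n = Nat.+-identityʳ (G 0)
sumTo-δ {c} {suc j} G c≤ with c ℕ.≟ suc j
... | yes refl rewrite dec-true (c ℕ.≟ c) refl =
  trans (cong (_+ (G c + 0)) (sumTo-δ-beyond G (Nat.n<1+n j))) (Nat.+-identityʳ (G c))
... | no c≢ rewrite dec-false (c ℕ.≟ suc j) c≢ =
  trans (Nat.+-identityʳ _) (sumTo-δ G (Nat.≤-pred (Nat.≤∧≢⇒< c≤ c≢)))

+≡ᵇ-∸ : (c x : ℕ) {j : ℕ} → c ≤ j → (c + x ≡ᵇ j) ≡ (x ≡ᵇ j ℕ.∸ c)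
+≡ᵇ-∸ zero    x _             = refl
+≡ᵇ-∸ (suc c) x (ℕ.s≤s c≤j) = +≡ᵇ-∸ c x c≤j

+≡ᵇ-beyond : (c x : ℕ) {j : ℕ} → j ℕ.< c → (c + x ≡ᵇ j) ≡ false
+≡ᵇ-beyond c x j<c = dec-false (c + x ℕ.≟ _) (λ { refl → Nat.<-irrefl refl (Nat.<-≤-trans j<c (Nat.m≤m+n c x)) })

genPoly-concatenations : (st a b : List ℤ → ℕ) (U W : List (List ℤ)) →
  (∀ {u v} → u ∈ U → v ∈ W → st (u ++ v) ≡ a u + b v) →
  ∀ j → genPoly (concatMap (λ u → map (u ++_) W) U) st j ≡ (genPoly U a ⊛ genPoly W b) j
genPoly-concatenations st a b []       W _        j = sym (sumTo-zero j _ (λ _ _ → refl))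
genPoly-concatenations st a b (u ∷ U) W additive j = begin
  count Q (map (u ++_) W ++ concatMap (λ u → map (u ++_) W) U)
    ≡⟨ count-++ Q (map (u ++_) W) _ ⟩
  count Q (map (u ++_) W) + count Q (concatMap (λ u → map (u ++_) W) U)
    ≡⟨ cong₂ _+_ count-u (genPoly-concatenations st a b U W (additive ∘ there) j) ⟩
  sumTo j (λ i → δ (a u) i * G i) + sumTo j (λ i → genPoly U a i * G i)
    ≡⟨ sumTo-+ j _ _ ⟨
  sumTo j (λ i → δ (a u) i * G i + genPoly U a i * G i)
    ≡⟨ sumTo-cong j (λ i → Nat.*-distribʳ-+ (G i) (δ (a u) i) _) ⟨
  (genPoly (u ∷ U) a ⊛ genPoly W b) j ∎
  where
  open ≡-Reasoning
  Q = λ w → st w ≡ᵇ j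
  G = λ i → genPoly W b (j ℕ.∸ i)
  count-u : count Q (map (u ++_) W) ≡ sumTo j (λ i → δ (a u) i * G i)
  count-u with a u ℕ.≤? j
  ... | yes au≤j = trans (count-map Q (u ++_) W)
    (trans (count-cong W (λ v v∈ → trans (cong (_≡ᵇ j) (additive (here refl) v∈)) (+≡ᵇ-∸ (a u) (b v) au≤j)))
           (sym (sumTo-δ G au≤j)))
  ... | no au≰j = trans (count-map Q (u ++_) W)
    (trans (count-none _ W (λ v v∈ → trans (cong (_≡ᵇ j) (additive (here refl) v∈))
                                             (+≡ᵇ-beyond (a u) (b v) (Nat.≰⇒> au≰j))))
           (sym (sumTo-δ-beyond G (Nat.≰⇒> au≰j))))

count-concatMap-upTo : (P : B → Bool) (f : ℕ → List B) (n : ℕ) →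
  count P (concatMap f (upTo (suc n))) ≡ sumTo n (λ k → count P (f k))
count-concatMap-upTo P f zero    = trans (count-++ P (f 0) []) (Nat.+-identityʳ _)
count-concatMap-upTo P f (suc n) = begin
  count P (concatMap f (upTo (suc (suc n))))
    ≡⟨ cong (count P ∘ concatMap f) (List.applyUpTo-∷ʳ (λ i → i) (suc n)) ⟨
  count P (concatMap f (upTo (suc n) ++ [ suc n ]))            ≡⟨ cong (count P) (List.concatMap-++ f (upTo (suc n)) _) ⟩
  count P (concatMap f (upTo (suc n)) ++ (f (suc n) ++ []))    ≡⟨ count-++ P (concatMap f (upTo (suc n))) _ ⟩
  count P (concatMap f (upTo (suc n))) + count P (f (suc n) ++ [])
    ≡⟨ cong₂ _+_ (count-concatMap-upTo P f n) (cong (count P) (List.++-identityʳ (f (suc n)))) ⟩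
  sumTo n (λ k → count P (f k)) + count P (f (suc n))          ∎
  where open ≡-Reasoning

Split : Set
Split = List ℤ × List ℤ

addLeft addRight : ℤ → Split → Split
addLeft  a (S , T) = a ∷ S , T
addRight a (S , T) = S , a ∷ T

splits : ℕ → List ℤ → List Split
splits zero    []       = ([] , []) ∷ []
splits (suc k) []       = []
splits zero    (a ∷ as) = map (addRight a) (splits zero as)
splits (suc k) (a ∷ as) = map (addLeft a) (splits k as) ++ map (addRight a) (splits (suc k) as)

length-splits : (k : ℕ) (L : List ℤ) → length (splits k L) ≡ length L C k
length-splits zero    []       = refl
length-splits (suc k) []       = refl
length-splits zero    (a ∷ as) = trans (List.length-map _ (splits zero as)) (length-splits zero as)
length-splits (suc k) (a ∷ as) = begin
  length (map (addLeft a) (splits k as) ++ map (addRight a) (splits (suc k) as))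
    ≡⟨ List.length-++ (map (addLeft a) (splits k as)) ⟩
  length (map (addLeft a) (splits k as)) + length (map (addRight a) (splits (suc k) as))
    ≡⟨ cong₂ _+_ (List.length-map _ (splits k as)) (List.length-map _ (splits (suc k) as)) ⟩
  length (splits k as) + length (splits (suc k) as)
    ≡⟨ cong₂ _+_ (length-splits k as) (length-splits (suc k) as) ⟩
  length as C k + length as C suc k
    ≡⟨ nCk+nC[k+1]≡[n+1]C[k+1] (length as) k ⟩
  suc (length as) C suc k ∎
  where open ≡-Reasoning

∈-splits⁻ : {S T : List ℤ} (k : ℕ) (L : List ℤ) → (S , T) ∈ splits k L → S ++ T ↭ L × length S ≡ k
∈-splits⁻ zero    []       (here refl) = ↭-refl , refl
∈-splits⁻ zero    (a ∷ as) m with ∈-map⁻ (addRight a) m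
... | (S , T) , m′ , refl with ∈-splits⁻ zero as m′
...   | ↭as , len = ↭-trans (Perm.shift a S T) (prep a ↭as) , len
∈-splits⁻ (suc k) (a ∷ as) m with ∈-++⁻ (map (addLeft a) (splits k as)) m
... | inj₁ m₁ with ∈-map⁻ (addLeft a) m₁
...   | (S , T) , m′ , refl with ∈-splits⁻ k as m′
...     | ↭as , len = prep a ↭as , cong suc len
∈-splits⁻ (suc k) (a ∷ as) m | inj₂ m₂ with ∈-map⁻ (addRight a) m₂
...   | (S , T) , m′ , refl with ∈-splits⁻ (suc k) as m′
...     | ↭as , len = ↭-trans (Perm.shift a S T) (prep a ↭as) , len

∈-splits⁺ : (p : ℤ → Bool) (L : List ℤ) →
  (filterᵇ p L , filterᵇ (not ∘ p) L) ∈ splits (length (filterᵇ p L)) L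
∈-splits⁺ p []       = here refl
∈-splits⁺ p (a ∷ as) with p a
... | true  = ∈-++⁺ˡ (∈-map⁺ (addLeft a) (∈-splits⁺ p as))
... | false with length (filterᵇ p as) | ∈-splits⁺ p as
...   | zero  | m = ∈-map⁺ (addRight a) m
...   | suc k | m = ∈-++⁺ʳ (map (addLeft a) (splits k as)) (∈-map⁺ (addRight a) m)

∉-splits-left : {a : ℤ} {S T : List ℤ} (k : ℕ) (L : List ℤ) → (S , T) ∈ splits k L → a ∉ L → a ∉ S
∉-splits-left k L m a∉L a∈S = a∉L (Perm.∈-resp-↭ (proj₁ (∈-splits⁻ k L m)) (∈-++⁺ˡ a∈S))

splits-recover : {S T : List ℤ} (k : ℕ) (L : List ℤ) → Unique L → (S , T) ∈ splits k L →
  filterᵇ (_∈ᵇ S) L ≡ S × filterᵇ (not ∘ (_∈ᵇ S)) L ≡ T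
splits-recover zero    []       _        (here refl) = refl , refl
splits-recover zero    (a ∷ as) (a∉ ∷ u) m with ∈-map⁻ (addRight a) m
... | (S , T) , m′ , refl
  rewrite dec-false (a ∈? S) (∉-splits-left zero as m′ (All.All¬⇒¬Any a∉)) with splits-recover zero as u m′
...   | S≡ , T≡ = S≡ , cong (a ∷_) T≡
splits-recover (suc k) (a ∷ as) (a∉ ∷ u) m with ∈-++⁻ (map (addLeft a) (splits k as)) m
... | inj₁ m₁ with ∈-map⁻ (addLeft a) m₁
...   | (S , T) , m′ , refl rewrite dec-true (a ∈? a ∷ S) (here refl) with splits-recover k as u m′
...     | S≡ , T≡ = cong (a ∷_) (trans (filterᵇ-cong as ∈ᵇ-a∷S) S≡) ,
                    trans (filterᵇ-cong as (λ x x∈ → cong not (∈ᵇ-a∷S x x∈))) T≡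
  where
  ∈ᵇ-a∷S : ∀ x → x ∈ as → x ∈ᵇ (a ∷ S) ≡ x ∈ᵇ S
  ∈ᵇ-a∷S x x∈ = does-⇔ (mk⇔ (λ { (here refl) → ⊥-elim (All.All¬⇒¬Any a∉ x∈) ; (there x∈S) → x∈S })
                              there)
                         (x ∈? a ∷ S) (x ∈? S)
splits-recover (suc k) (a ∷ as) (a∉ ∷ u) m | inj₂ m₂ with ∈-map⁻ (addRight a) m₂
...   | (S , T) , m′ , refl
  rewrite dec-false (a ∈? S) (∉-splits-left (suc k) as m′ (All.All¬⇒¬Any a∉)) with splits-recover (suc k) as u m′
...     | S≡ , T≡ = S≡ , cong (a ∷_) T≡

unique-splits : (k : ℕ) {L : List ℤ} → Unique L → Unique (splits k L)
unique-splits zero    {[]}     _        = [] ∷ []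
unique-splits (suc k) {[]}     _        = []
unique-splits zero    {a ∷ as} (_ ∷ u) = Unique.map⁺ addRight-injective (unique-splits zero u)
  where
  addRight-injective : ∀ {x y} → addRight a x ≡ addRight a y → x ≡ y
  addRight-injective {_ , _} {_ , _} refl = refl
unique-splits (suc k) {a ∷ as} (a∉ ∷ u) =
  Unique.++⁺ (Unique.map⁺ addLeft-injective (unique-splits k u))
             (Unique.map⁺ addRight-injective (unique-splits (suc k) u)) disjoint
  where
  addLeft-injective : ∀ {x y} → addLeft a x ≡ addLeft a y → x ≡ y
  addLeft-injective {_ , _} {_ , _} refl = refl
  addRight-injective : ∀ {x y} → addRight a x ≡ addRight a y → x ≡ y
  addRight-injective {_ , _} {_ , _} refl = refl
  disjoint : ∀ {v} → v ∈ map (addLeft a) (splits k as) × v ∈ map (addRight a) (splits (suc k) as) → ⊥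
  disjoint (m₁ , m₂) with ∈-map⁻ (addLeft a) m₁
  ... | _ , _ , refl with ∈-map⁻ (addRight a) m₂
  ...   | _ , m′ , refl = ∉-splits-left (suc k) as m′ (All.All¬⇒¬Any a∉) (here refl)

partition-↭ : {X Y L : List ℤ} → Unique L → X ++ Y ↭ L →
  filterᵇ (_∈ᵇ X) L ↭ X × filterᵇ (not ∘ (_∈ᵇ X)) L ↭ Y
partition-↭ {X} {Y} {L} u XY↭L =
  unique∧set⇒↭ (unique-filterᵇ _ u) (unique-++⁻ˡ X uXY) (mk⇔ left⁻ left⁺) ,
  unique∧set⇒↭ (unique-filterᵇ _ u) (unique-++⁻ʳ X uXY) (mk⇔ right⁻ right⁺)
  where
  uXY : Unique (X ++ Y)
  uXY = Unique-resp-↭ (↭-sym XY↭L) u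
  ∈L : ∀ {z} → z ∈ X ++ Y → z ∈ L
  ∈L = Perm.∈-resp-↭ XY↭L
  left⁻ : ∀ {z} → z ∈ filterᵇ (_∈ᵇ X) L → z ∈ X
  left⁻ {z} m = does-true⇒ (z ∈? X) (proj₂ (∈-filterᵇ⁻ _ L m))
  left⁺ : ∀ {z} → z ∈ X → z ∈ filterᵇ (_∈ᵇ X) L
  left⁺ {z} z∈X = ∈-filterᵇ⁺ _ (∈L (∈-++⁺ˡ z∈X)) (dec-true (z ∈? X) z∈X)
  right⁻ : ∀ {z} → z ∈ filterᵇ (not ∘ (_∈ᵇ X)) L → z ∈ Y
  right⁻ {z} m with ∈-filterᵇ⁻ _ L m
  ... | z∈L , z∉X with ∈-++⁻ X (Perm.∈-resp-↭ (↭-sym XY↭L) z∈L)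
  ...   | inj₁ z∈X = ⊥-elim (does-false⇒ (z ∈? X) (not-injective z∉X) z∈X)
  ...   | inj₂ z∈Y = z∈Y
  right⁺ : ∀ {z} → z ∈ Y → z ∈ filterᵇ (not ∘ (_∈ᵇ X)) L
  right⁺ {z} z∈Y = ∈-filterᵇ⁺ _ (∈L (∈-++⁺ʳ X z∈Y))
    (cong not (dec-false (z ∈? X) (λ z∈X → unique-++⇒disjoint X uXY z∈X z∈Y)))

-- Cutting a signed permutation after its sign prefix

signed : Sign → ℤ → ℤ
signed neg x = - x
signed pos x = x

hasSign-signed : (σ : Sign) {s : ℤ} → 0ℤ ℤ.< s → hasSign σ (signed σ s) ≡ true
hasSign-signed neg {+ zero}  (+<+ ())
hasSign-signed neg {+ suc n} _   = refl
hasSign-signed pos           s>0 = dec-true (0ℤ ℤ.<? _) s>0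

signed-abs : (σ : Sign) (x : ℤ) → hasSign σ x ≡ true → signed σ (abs x) ≡ x
signed-abs neg -[1+ n ] _ = refl
signed-abs pos (+ n)    _ = refl

signed-injective : (σ : Sign) {x y : ℤ} → signed σ x ≡ signed σ y → x ≡ y
signed-injective neg eq = ℤ.neg-injective eq
signed-injective pos eq = eq

map-abs-signed : (σ : Sign) {S : List ℤ} → All (0ℤ ℤ.<_) S → map abs (map (signed σ) S) ≡ S
map-abs-signed σ   []           = refl
map-abs-signed neg {s ∷ _} (s>0 ∷ S>0) = cong₂ _∷_ (trans (abs-neg s) (abs-pos s>0)) (map-abs-signed neg S>0)
map-abs-signed pos (s>0 ∷ S>0) = cong₂ _∷_ (abs-pos s>0) (map-abs-signed pos S>0)

map-signed-abs : (σ : Sign) {u : List ℤ} → All (λ a → hasSign σ a ≡ true) u → map (signed σ) (map abs u) ≡ u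
map-signed-abs σ []              = refl
map-signed-abs σ {a ∷ _} (σa ∷ σu) = cong₂ _∷_ (signed-abs σ a σa) (map-signed-abs σ σu)

signPrefix signRest : Sign → List ℤ → List ℤ
signPrefix σ []      = []
signPrefix σ (a ∷ w) = if hasSign σ a then a ∷ signPrefix σ w else []
signRest σ []      = []
signRest σ (a ∷ w) = if hasSign σ a then signRest σ w else a ∷ w

signPrefix++signRest : (σ : Sign) (w : List ℤ) → signPrefix σ w ++ signRest σ w ≡ w
signPrefix++signRest σ []      = refl
signPrefix++signRest σ (a ∷ w) with hasSign σ a
... | true  = cong (a ∷_) (signPrefix++signRest σ w)
... | false = refl

signPrefix-hasSign : (σ : Sign) (w : List ℤ) → All (λ a → hasSign σ a ≡ true) (signPrefix σ w)
signPrefix-hasSign σ []      = []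
signPrefix-hasSign σ (a ∷ w) with hasSign σ a in σa
... | true  = σa ∷ signPrefix-hasSign σ w
... | false = []

signRest-startsWith : (σ : Sign) (w : List ℤ) → startsWith σ (signRest σ w) ≡ false
signRest-startsWith σ []      = refl
signRest-startsWith σ (a ∷ w) with hasSign σ a in σa
... | true  = signRest-startsWith σ w
... | false = σa

signPrefix-++ : (σ : Sign) {u : List ℤ} (v : List ℤ) → All (λ a → hasSign σ a ≡ true) u →
  startsWith σ v ≡ false → signPrefix σ (u ++ v) ≡ u
signPrefix-++ σ []      []       _ = refl
signPrefix-++ σ (b ∷ v) []       σb rewrite σb = refl
signPrefix-++ σ {a ∷ u} v (σa ∷ σu) σv rewrite σa = cong (a ∷_) (signPrefix-++ σ v σu σv)

joins : Sign → Split → List (List ℤ)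
joins σ (S , T) = concatMap (λ u → map (u ++_) (tailWords σ T)) (perms (map (signed σ) S))

joinsOfSize : Sign → ℕ → ℕ → List (List ℤ)
joinsOfSize σ n k = concatMap (joins σ) (splits k (range n))

decompositions : Sign → ℕ → List (List ℤ)
decompositions σ n = concatMap (joinsOfSize σ n) (upTo (suc n))

perms-signed-hasSign : (σ : Sign) {S u : List ℤ} → All (0ℤ ℤ.<_) S → u ∈ perms (map (signed σ) S) →
  All (λ a → hasSign σ a ≡ true) u
perms-signed-hasSign σ S>0 u∈ = ∈-perms-All (All.map⁺ (All.map (hasSign-signed σ) S>0)) u∈

∈-joins⁻ : {σ : Sign} {S T w : List ℤ} → w ∈ joins σ (S , T) →
  ∃₂ λ u v → u ∈ perms (map (signed σ) S) × v ∈ tailWords σ T × w ≡ u ++ v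
∈-joins⁻ {σ} {S} m with ∈-concatMap⁻ (perms (map (signed σ) S)) m
... | u , u∈ , m′ with ∈-map⁻ (u ++_) m′
...   | v , v∈ , eq = u , v , u∈ , v∈ , eq

record SplitOfRange (n k : ℕ) (S T : List ℤ) : Set where
  field
    ↭range   : S ++ T ↭ range n
    length-S : length S ≡ k
    S>0      : All (0ℤ ℤ.<_) S
    T>0      : All (0ℤ ℤ.<_) T
    unique-S : Unique S
    unique-T : Unique T

splitOfRange : {n k : ℕ} {S T : List ℤ} → (S , T) ∈ splits k (range n) → SplitOfRange n k S T
splitOfRange {n} {k} m with ∈-splits⁻ k (range n) m
... | ↭range , length-S = record
  { ↭range = ↭range ; length-S = length-S
  ; S>0 = All.++⁻ˡ _ ST>0 ; T>0 = All.++⁻ʳ _ ST>0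
  ; unique-S = unique-++⁻ˡ _ uST ; unique-T = unique-++⁻ʳ _ uST }
  where
  ST>0 = Perm.All-resp-↭ (↭-sym ↭range) (range-pos n)
  uST = Unique-resp-↭ (↭-sym ↭range) (unique-range n)

signPrefix-join : {σ : Sign} {S T u v : List ℤ} → All (0ℤ ℤ.<_) S →
  u ∈ perms (map (signed σ) S) → v ∈ tailWords σ T → signPrefix σ (u ++ v) ≡ u
signPrefix-join {σ} {T = T} {v = v} S>0 u∈ v∈ =
  signPrefix-++ σ v (perms-signed-hasSign σ S>0 u∈) (tailWords-startsWith {T = T} v∈)

abs-perms-signed : (σ : Sign) {S u : List ℤ} → All (0ℤ ℤ.<_) S → u ∈ perms (map (signed σ) S) → map abs u ↭ S
abs-perms-signed σ {S} S>0 u∈ = subst (_ ↭_) (map-abs-signed σ S>0) (Perm.map⁺ abs (∈-perms⁻ _ u∈))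

module Decomposition (σ : Sign) (n : ℕ) where

  L : List ℤ
  L = range n

  decompositions⊆signedPerms : ∀ {w} → w ∈ decompositions σ n → w ∈ signedPerms L
  decompositions⊆signedPerms m with ∈-concatMap⁻ (upTo (suc n)) m
  ... | k , _ , m₁ with ∈-concatMap⁻ (splits k L) m₁
  ...   | (S , T) , ST∈ , m₂ with ∈-joins⁻ {σ} {S} {T} m₂
  ...     | u , v , u∈ , v∈ , refl = ∈-signedPerms⁺ L (begin
    map abs (u ++ v)        ≡⟨ List.map-++ abs u v ⟩
    map abs u ++ map abs v  ↭⟨ Perm.++⁺ (abs-perms-signed σ S>0 u∈)
                                        (∈-signedPerms⁻ T>0 (∈-tailWords-signedPerms {σ} {T} v∈)) ⟩
    S ++ T                  ↭⟨ ↭range ⟩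
    L                       ∎)
    where
    open SplitOfRange (splitOfRange {n} {k} ST∈)
    open Perm.PermutationReasoning

  signedPerms⊆decompositions : ∀ {w} → w ∈ signedPerms L → w ∈ decompositions σ n
  signedPerms⊆decompositions {w} w∈ =
    ∈-concatMap⁺ (∈-upTo⁺ (ℕ.s≤s k≤n)) (∈-concatMap⁺ ST∈ (∈-concatMap⁺ u∈
      (subst (_∈ map (u ++_) (tailWords σ T)) (signPrefix++signRest σ w) (∈-map⁺ (u ++_) v∈))))
    where
    u = signPrefix σ w
    v = signRest σ w
    uv↭L : map abs u ++ map abs v ↭ L
    uv↭L = subst (_↭ L) (trans (cong (map abs) (sym (signPrefix++signRest σ w))) (List.map-++ abs u v))
                 (∈-signedPerms⁻ (range-pos n) w∈)
    S = filterᵇ (_∈ᵇ map abs u) L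
    T = filterᵇ (not ∘ (_∈ᵇ map abs u)) L
    k = length S
    ST∈ : (S , T) ∈ splits k L
    ST∈ = ∈-splits⁺ _ L
    k≤n : k ≤ n
    k≤n = subst (k ≤_) (length-range n) (length-filterᵇ _ L)
    S↭ = proj₁ (partition-↭ (unique-range n) uv↭L)
    T↭ = proj₂ (partition-↭ (unique-range n) uv↭L)
    u∈ : u ∈ perms (map (signed σ) S)
    u∈ = ∈-perms⁺ _ (subst (_↭ map (signed σ) S) (map-signed-abs σ (signPrefix-hasSign σ w))
                           (Perm.map⁺ (signed σ) (↭-sym S↭)))
    v∈ : v ∈ tailWords σ T
    v∈ = ∈-filterᵇ⁺ _ (∈-signedPerms⁺ T (↭-sym T↭)) (cong not (signRest-startsWith σ w))

  signPrefix-joins : ∀ {k S T u v} → (S , T) ∈ splits k L →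
    u ∈ perms (map (signed σ) S) → v ∈ tailWords σ T → signPrefix σ (u ++ v) ≡ u
  signPrefix-joins {k} {T = T} ST∈ = signPrefix-join {T = T} (SplitOfRange.S>0 (splitOfRange {n} {k} ST∈))

  unique-joins : ∀ {k S T} → (S , T) ∈ splits k L → Unique (joins σ (S , T))
  unique-joins {k} {S} {T} ST∈ =
    unique-concatMap⁺ (signPrefix σ) (perms (map (signed σ) S))
      (unique-perms ℤ._≟_ _ (Unique.map⁺ (signed-injective σ) unique-S))
      (λ u _ → Unique.map⁺ (List.++-cancelˡ u _ _) (unique-filterᵇ _ (unique-signedPerms unique-T T>0)))
      prefix-recovers
    where
    open SplitOfRange (splitOfRange {n} {k} ST∈)
    prefix-recovers : ∀ u w → u ∈ perms (map (signed σ) S) → w ∈ map (u ++_) (tailWords σ T) → signPrefix σ w ≡ u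
    prefix-recovers u w u∈ w∈ with ∈-map⁻ (u ++_) w∈
    ... | v , v∈ , refl = signPrefix-joins {k} ST∈ u∈ v∈

  splitOf : List ℤ → Split
  splitOf w = filterᵇ (_∈ᵇ map abs (signPrefix σ w)) L , filterᵇ (not ∘ (_∈ᵇ map abs (signPrefix σ w))) L

  unique-joinsOfSize : ∀ k → Unique (joinsOfSize σ n k)
  unique-joinsOfSize k =
    unique-concatMap⁺ splitOf (splits k L) (unique-splits k (unique-range n)) (λ _ → unique-joins {k}) split-recovers
    where
    split-recovers : ∀ ST w → ST ∈ splits k L → w ∈ joins σ ST → splitOf w ≡ ST
    split-recovers (S , T) w ST∈ w∈ with ∈-joins⁻ {σ} {S} {T} w∈ | splits-recover k L (unique-range n) ST∈
    ... | u , v , u∈ , v∈ , refl | S≡ , T≡ rewrite signPrefix-joins {k} ST∈ u∈ v∈ =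
      cong₂ _,_ (trans (filterᵇ-cong L ∈ᵇ-S) S≡) (trans (filterᵇ-cong L (λ x x∈ → cong not (∈ᵇ-S x x∈))) T≡)
      where
      open SplitOfRange (splitOfRange {n} {k} ST∈)
      ∈ᵇ-S : ∀ x → x ∈ L → x ∈ᵇ map abs u ≡ x ∈ᵇ S
      ∈ᵇ-S x _ = does-⇔ (mk⇔ (Perm.∈-resp-↭ abs-u↭S) (Perm.∈-resp-↭ (↭-sym abs-u↭S))) (x ∈? map abs u) (x ∈? S)
        where abs-u↭S = abs-perms-signed σ S>0 u∈

  unique-decompositions : Unique (decompositions σ n)
  unique-decompositions =
    unique-concatMap⁺ (length ∘ signPrefix σ) (upTo (suc n)) (Unique.upTo⁺ (suc n))
      (λ k _ → unique-joinsOfSize k) prefix-length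
    where
    prefix-length : ∀ k w → k ∈ upTo (suc n) → w ∈ joinsOfSize σ n k → length (signPrefix σ w) ≡ k
    prefix-length k w _ w∈ with ∈-concatMap⁻ (splits k L) w∈
    ... | (S , T) , ST∈ , m with ∈-joins⁻ {σ} {S} {T} m
    ...   | u , v , u∈ , v∈ , refl rewrite signPrefix-joins {k} ST∈ u∈ v∈ =
      trans (Perm.↭-length (∈-perms⁻ (map (signed σ) S) u∈)) (trans (List.length-map (signed σ) S) length-S)
      where open SplitOfRange (splitOfRange {n} {k} ST∈)

  decompositions-↭ : decompositions σ n ↭ signedPerms L
  decompositions-↭ = unique∧set⇒↭ unique-decompositions (unique-signedPerms (unique-range n) (range-pos n))
    (mk⇔ decompositions⊆signedPerms signedPerms⊆decompositions)

-- Descents across the cut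

desA-++-ascent : {a b : ℤ} (u v : List ℤ) → All (ℤ._< b) (a ∷ u) →
  desA (a ∷ u ++ b ∷ v) ≡ desA (a ∷ u) + desA (b ∷ v)
desA-++-ascent {a} {b} []      v (a<b ∷ []) rewrite dec-false (b ℤ.<? a) (ℤ.<-asym a<b) = refl
desA-++-ascent {a} (c ∷ u) v (_ ∷ u<b) =
  trans (cong₂ _+_ refl (desA-++-ascent u v u<b))
        (sym (Nat.+-assoc (if does (c ℤ.<? a) then 1 else 0) _ _))

desA-++-descent : {a b : ℤ} (u v : List ℤ) → All (b ℤ.<_) (a ∷ u) →
  desA (a ∷ u ++ b ∷ v) ≡ desA (a ∷ u) + suc (desA (b ∷ v))
desA-++-descent {a} {b} []      v (b<a ∷ []) rewrite dec-true (b ℤ.<? a) b<a = refl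
desA-++-descent {a} (c ∷ u) v (_ ∷ b<u) =
  trans (cong₂ _+_ refl (desA-++-descent u v b<u))
        (sym (Nat.+-assoc (if does (c ℤ.<? a) then 1 else 0) _ _))

desB-positive : {u : List ℤ} → All (0ℤ ℤ.<_) u → desB u ≡ desA u
desB-positive []          = refl
desB-positive (a>0 ∷ _) rewrite dec-false (_ ℤ.<? 0ℤ) (ℤ.<-asym a>0) = refl

-- On a nonempty word, desA⁺ also counts the descent from a preceding nonnegative letter into a negative first letter.
desA⁺ : List ℤ → ℕ
desA⁺ []      = 0
desA⁺ (a ∷ r) = suc (desA (a ∷ r))

wordStat tailStat : Sign → List ℤ → ℕ
wordStat neg = desA
wordStat pos = desB
tailStat neg = desA
tailStat pos = desA⁺

tailSeries : Sign → Series
tailSeries neg = CE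
tailSeries pos = onePlusX CO

tailStat-orderInvariant : (σ : Sign) → OrderInvariant (tailStat σ)
tailStat-orderInvariant neg         = desA-orderInvariant
tailStat-orderInvariant pos g []      _    = refl
tailStat-orderInvariant pos g (a ∷ r) mono = cong suc (desA-orderInvariant g (a ∷ r) mono)

desA-++-neg : (u v : List ℤ) → All (ℤ._< 0ℤ) u → startsWith neg v ≡ false → desA (u ++ v) ≡ desA u + desA v
desA-++-neg []      v       _   _   = refl
desA-++-neg (a ∷ u) []      _   _   = trans (cong desA (List.++-identityʳ (a ∷ u))) (sym (Nat.+-identityʳ _))
desA-++-neg (a ∷ u) (b ∷ v) u<0 b≮0 =
  desA-++-ascent u v (All.map (λ x<0 → ℤ.<-≤-trans x<0 (ℤ.≮⇒≥ (does-false⇒ (b ℤ.<? 0ℤ) b≮0))) u<0)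

desB-++-descent : {u : List ℤ} {b : ℤ} (v : List ℤ) → All (0ℤ ℤ.<_) u → b ℤ.< 0ℤ →
  desB (u ++ b ∷ v) ≡ desA u + desA⁺ (b ∷ v)
desB-++-descent {u} v u>0 b<0 =
  trans (desA-++-descent u v (b<0 ∷ All.map (ℤ.<-trans b<0) u>0)) (cong (_+ _) (desB-positive u>0))

nonzero∧≯0⇒<0 : {b : ℤ} → 0ℤ ℤ.< abs b → ¬ 0ℤ ℤ.< b → b ℤ.< 0ℤ
nonzero∧≯0⇒<0 {+ zero}   (+<+ ()) _
nonzero∧≯0⇒<0 {+ suc n}  _        b≯0 = ⊥-elim (b≯0 (+<+ z<s))
nonzero∧≯0⇒<0 { -[1+ n ]} _        _   = -<+

wordStat-join : (σ : Sign) {S T u v : List ℤ} → All (0ℤ ℤ.<_) S → All (0ℤ ℤ.<_) T →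
  u ∈ perms (map (signed σ) S) → v ∈ tailWords σ T → wordStat σ (u ++ v) ≡ desA u + tailStat σ v
wordStat-join neg {T = T} {u} {v} S>0 _ u∈ v∈ =
  desA-++-neg u v (All.map (does-true⇒ (_ ℤ.<? 0ℤ)) (perms-signed-hasSign neg S>0 u∈)) (tailWords-startsWith {T = T} v∈)
wordStat-join pos {u = u} {[]} S>0 _ u∈ _ =
  trans (cong desB (List.++-identityʳ u)) (trans (desB-positive u>0) (sym (Nat.+-identityʳ _)))
  where u>0 = All.map (does-true⇒ (0ℤ ℤ.<? _)) (perms-signed-hasSign pos S>0 u∈)
wordStat-join pos {T = T} {u} {b ∷ v} S>0 T>0 u∈ v∈ = desB-++-descent v u>0 b<0
  where
  u>0 = All.map (does-true⇒ (0ℤ ℤ.<? _)) (perms-signed-hasSign pos S>0 u∈)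
  b<0 = nonzero∧≯0⇒<0 (All.lookup T>0 (∈-signedPerms-abs T>0 (∈-tailWords-signedPerms {pos} {T} v∈) (here refl)))
                      (does-false⇒ (0ℤ ℤ.<? b) (tailWords-startsWith {T = T} v∈))

signedPerms-nonempty : (m : ℕ) {w : List ℤ} → w ∈ signedPerms (range (suc m)) →
  ∃₂ λ a r → w ≡ a ∷ r × 0ℤ ℤ.< abs a
signedPerms-nonempty m {[]} w∈ with trans (Perm.↭-length (∈-signedPerms⁻ (range-pos (suc m)) w∈)) (length-range (suc m))
... | ()
signedPerms-nonempty m {a ∷ r} w∈ =
  a , r , refl , All.lookup (range-pos (suc m)) (∈-signedPerms-abs (range-pos (suc m)) w∈ (here refl))

not-startsWith-neg : (a : ℤ) (r : List ℤ) → 0ℤ ℤ.< abs a → not (startsWith neg (a ∷ r)) ≡ firstPos (a ∷ r)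
not-startsWith-neg (+ zero)  r (+<+ ())
not-startsWith-neg (+ suc n) r _ = refl
not-startsWith-neg -[1+ n ]  r _ = refl

not-startsWith-pos : (a : ℤ) (r : List ℤ) → 0ℤ ℤ.< abs a → not (startsWith pos (a ∷ r)) ≡ firstNeg (a ∷ r)
not-startsWith-pos (+ zero)  r (+<+ ())
not-startsWith-pos (+ suc n) r _ = refl
not-startsWith-pos -[1+ n ]  r _ = refl

genPoly-tailWords-range : (σ : Sign) (m i : ℕ) → genPoly (tailWords σ (range m)) (tailStat σ) i ≡ tailSeries σ m i
genPoly-tailWords-range neg zero    zero    = refl
genPoly-tailWords-range neg zero    (suc i) = refl
genPoly-tailWords-range pos zero    zero    = refl
genPoly-tailWords-range pos zero    (suc i) = refl
genPoly-tailWords-range neg (suc m) i = cong (count (λ w → desA w ≡ᵇ i)) (filterᵇ-cong (SymB (suc m)) first-letter)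
  where
  first-letter : ∀ w → w ∈ SymB (suc m) → not (startsWith neg w) ≡ firstPos w
  first-letter w w∈ with signedPerms-nonempty m w∈
  ... | a , r , refl , a≢0 = not-startsWith-neg a r a≢0
genPoly-tailWords-range pos (suc m) i =
  trans (cong (count (λ w → desA⁺ w ≡ᵇ i)) (filterᵇ-cong (SymB (suc m)) first-letter)) (shift i)
  where
  first-letter : ∀ w → w ∈ SymB (suc m) → not (startsWith pos w) ≡ firstNeg w
  first-letter w w∈ with signedPerms-nonempty m w∈
  ... | a , r , refl , a≢0 = not-startsWith-pos a r a≢0
  W = filterᵇ firstNeg (SymB (suc m))
  desA⁺≢0 : ∀ w → w ∈ W → (desA⁺ w ≡ᵇ 0) ≡ false
  desA⁺≢0 w w∈ with signedPerms-nonempty m (proj₁ (∈-filterᵇ⁻ firstNeg (SymB (suc m)) w∈))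
  ... | _ , _ , refl , _ = refl
  desA⁺-suc : ∀ i w → w ∈ W → (desA⁺ w ≡ᵇ suc i) ≡ (desA w ≡ᵇ i)
  desA⁺-suc i w w∈ with signedPerms-nonempty m (proj₁ (∈-filterᵇ⁻ firstNeg (SymB (suc m)) w∈))
  ... | _ , _ , refl , _ = refl
  shift : ∀ i → count (λ w → desA⁺ w ≡ᵇ i) W ≡ xP (genPoly W desA) i
  shift zero    = count-none _ W desA⁺≢0
  shift (suc i) = count-cong W (desA⁺-suc i)

genPoly-joins : (σ : Sign) {n k : ℕ} {S T : List ℤ} → (S , T) ∈ splits k (range n) →
  ∀ j → genPoly (joins σ (S , T)) (wordStat σ) j ≡ (Aₙ k ⊛ tailSeries σ (n ℕ.∸ k)) j
genPoly-joins σ {n} {k} {S} {T} ST∈ j =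
  trans (genPoly-concatenations (wordStat σ) desA (tailStat σ) (perms (map (signed σ) S)) (tailWords σ T)
           (wordStat-join σ S>0 T>0) j)
        (sumTo-cong j (λ i → cong₂ _*_ (perms-count i) (tails-count (j ℕ.∸ i))))
  where
  open SplitOfRange (splitOfRange {n} {k} ST∈)
  length-T : length T ≡ n ℕ.∸ k
  length-T = begin
    length T                         ≡⟨ Nat.m+n∸m≡n k (length T) ⟨
    k + length T ℕ.∸ k               ≡⟨ cong (λ l → l + length T ℕ.∸ k) length-S ⟨
    length S + length T ℕ.∸ k        ≡⟨ cong (ℕ._∸ k) (List.length-++ S) ⟨
    length (S ++ T) ℕ.∸ k            ≡⟨ cong (ℕ._∸ k) (trans (Perm.↭-length ↭range) (length-range n)) ⟩
    n ℕ.∸ k                          ∎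
    where open ≡-Reasoning
  perms-count : ∀ i → genPoly (perms (map (signed σ) S)) desA i ≡ Aₙ k i
  perms-count i = trans (genPoly-perms desA desA-orderInvariant (Unique.map⁺ (signed-injective σ) unique-S) i)
                        (cong (λ l → genPoly (Sym l) desA i) (trans (List.length-map (signed σ) S) length-S))
  tails-count : ∀ i → genPoly (tailWords σ T) (tailStat σ) i ≡ tailSeries σ (n ℕ.∸ k) i
  tails-count i = trans (genPoly-tailWords σ (tailStat σ) (tailStat-orderInvariant σ) unique-T T>0 i)
    (trans (cong (λ l → genPoly (tailWords σ (range l)) (tailStat σ) i) length-T) (genPoly-tailWords-range σ (n ℕ.∸ k) i))

genPoly-decompositions : (σ : Sign) (n j : ℕ) →
  genPoly (decompositions σ n) (wordStat σ) j ≡ egfMul Aser (tailSeries σ) n j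
genPoly-decompositions σ n j =
  trans (count-concatMap-upTo Q (joinsOfSize σ n) n) (sumTo-cong n splits-count)
  where
  Q = λ w → wordStat σ w ≡ᵇ j
  splits-count : ∀ k → count Q (joinsOfSize σ n k) ≡ (n C k) * (Aₙ k ⊛ tailSeries σ (n ℕ.∸ k)) j
  splits-count k =
    trans (count-concatMap-const Q (joins σ) (splits k (range n)) _ (λ _ ST∈ → genPoly-joins σ {n} {k} ST∈ j))
          (cong (_* (Aₙ k ⊛ tailSeries σ (n ℕ.∸ k)) j) (trans (length-splits k (range n)) (cong (_C k) (length-range n))))

theorem2p2 : ((n j : ℕ) → dilate2 Aser n j ≡ egfMul Aser CE n j)
           × ((n j : ℕ) → Bser n j ≡ egfMul Aser (onePlusX CO) n j)
theorem2p2 = dilation , typeB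
  where
  dilation : (n j : ℕ) → dilate2 Aser n j ≡ egfMul Aser CE n j
  dilation n j = begin
    2 ^ n * Aₙ n j                                         ≡⟨ cong (λ l → 2 ^ l * genPoly (Sym l) desA j) (length-range n) ⟨
    2 ^ length (range n) * genPoly (Sym (length (range n))) desA j
                                                           ≡⟨ genPoly-signedPerms (range-pos n) (unique-range n) j ⟨
    genPoly (signedPerms (range n)) desA j                 ≡⟨ count-↭ _ (Decomposition.decompositions-↭ neg n) ⟨
    genPoly (decompositions neg n) desA j                  ≡⟨ genPoly-decompositions neg n j ⟩
    egfMul Aser CE n j                                     ∎
    where open ≡-Reasoning
  typeB : (n j : ℕ) → Bser n j ≡ egfMul Aser (onePlusX CO) n j
  typeB n j = trans (count-↭ _ (↭-sym (Decomposition.decompositions-↭ pos n))) (genPoly-decompositions pos n j)
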